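{- Let $d,k$ be integers with $k\ge 1$ and $2k+1\le d$. The unique normalized Belyi map $f$ of combinatorial type $(d; d-k, 2k+1, d-k)$ is \[ f(x) = x^{d-k}\,\frac{a_0 x^k - a_1 x^{k-1} + \cdots + (-1)^k a_k}{(-1)^k a_k x^k + \cdots - a_1 x + a_0} = x^{d-k}\,\frac{\sum_{i=0}^k (-1)^i a_i x^{k-i}}{\sum_{i=0}^k (-1)^i a_i x^{i}}, \] where for $0\le i\le k$ \[ a_i = \binom{k}{i}\prod_{k+i+1\le j\le 2k}(d-j)\prod_{0\le j\le i-1}(d-j) = k!\binom{d}{i}\binom{d-k-i-1}{k-i}. \]
   Context: A normalized Belyi map of combinatorial type $(d; e_1,e_2,e_3)$ (with integers $2\le e_i\le d$, $e_1+e_2+e_3=2d+1$) is a rational function $f \in \mathbb{C}(x)$ of degree $d$, viewed as a map $\mathbb{P}^1_{\mathbb{C}}\to\mathbb{P}^1_{\mathbb{C}}$, whose only ramification points are $0$, $1$, $\infty$, with ramification indices $e_1$, $e_2$, $e_3$ respectively, and which satisfies $f(0)=0$, $f(1)=1$, $f(\infty)=\infty$. Such a map exists, is unique, and lies in $\mathbb{Q}(x)$. -}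

module Defs where

open import Data.Nat as ℕ using (ℕ; zero; suc; _∸_; _<_)
open import Data.Nat.Combinatorics using (_C_)
open import Data.Integer as ℤ using (+_)
open import Data.Rational as ℚ using (ℚ; 0ℚ; 1ℚ; _/_)
open import Data.List as List using (List; []; _∷_; applyUpTo; map; foldr)
open import Data.Product using (Σ; ∃; _×_)
open import Relation.Binary.PropositionalEquality using (_≡_; _≢_)

-- Polynomials in one variable x over ℚ, as coefficient lists
-- (lowest degree first).  Trailing zeros are allowed; equality of
-- polynomials is coefficientwise (_≈ₚ_).

Poly : Set
Poly = List ℚ

coeff : Poly → ℕ → ℚ
coeff []       _       = 0ℚ
coeff (c ∷ p)  zero    = c
coeff (c ∷ p)  (suc n) = coeff p n

_≈ₚ_ : Poly → Poly → Set
p ≈ₚ q = ∀ n → coeff p n ≡ coeff q n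

infix 4 _≈ₚ_
infixl 6 _+ₚ_ _-ₚ_
infixl 7 _*ₚ_ _·ₚ_
infixr 8 _^ₚ_

constₚ : ℚ → Poly
constₚ c = c ∷ []

X : Poly
X = 0ℚ ∷ 1ℚ ∷ []

_+ₚ_ : Poly → Poly → Poly
[]      +ₚ q       = q
(a ∷ p) +ₚ []      = a ∷ p
(a ∷ p) +ₚ (b ∷ q) = (a ℚ.+ b) ∷ (p +ₚ q)

_·ₚ_ : ℚ → Poly → Poly
c ·ₚ p = map (c ℚ.*_) p

-ₚ_ : Poly → Poly
-ₚ p = map ℚ.-_ p

_-ₚ_ : Poly → Poly → Poly
p -ₚ q = p +ₚ (-ₚ q)

_*ₚ_ : Poly → Poly → Poly
[]      *ₚ q = []
(a ∷ p) *ₚ q = (a ·ₚ q) +ₚ (0ℚ ∷ (p *ₚ q))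

_^ₚ_ : Poly → ℕ → Poly
p ^ₚ zero  = constₚ 1ℚ
p ^ₚ suc n = p *ₚ (p ^ₚ n)

eval : Poly → ℚ → ℚ
eval p x = foldr (λ c acc → c ℚ.+ x ℚ.* acc) 0ℚ p

ℕ→ℚ : ℕ → ℚ
ℕ→ℚ n = (+ n) / 1

deriv : Poly → Poly
deriv []      = []
deriv (_ ∷ p) = go 1 p
  where
  go : ℕ → Poly → Poly
  go _ []      = []
  go k (c ∷ q) = (ℕ→ℚ k ℚ.* c) ∷ go (suc k) q

DegreeIs : Poly → ℕ → Set
DegreeIs p n = (coeff p n ≢ 0ℚ) × (∀ m → n < m → coeff p m ≡ 0ℚ)

--  * coprime     : N and D are coprime in ℚ[x] (f = N/D in lowest terms)
--  * degN, degD  : deg N = d, deg D = d - e₃; since e₃ ≥ 1 this means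
--                  deg f = d, f(∞) = ∞, and the ramification index at ∞
--                  is deg N - deg D = e₃
--  * at0         : N = x^e₁ · N₁ with N₁(0) ≠ 0, i.e. f(0) = 0 with
--                  ramification index e₁ (D(0) ≠ 0 by coprimality)
--  * at1         : N - D = (x-1)^e₂ · M with M(1) ≠ 0, i.e. f(1) = 1 with
--                  ramification index e₂
--  * unramified  : the Wronskian N'D - ND' is c · x^(e₁-1) (x-1)^(e₂-1)
--                  with c ≠ 0.  For coprime N, D the finite ramification
--                  points of f (over ℂ) are exactly the roots of N'D - ND',
--                  a point of index e being a root of multiplicity e - 1;
--                  so this says that f is unramified at every finite point
--                  of ℂ other than 0 and 1.

record IsNormalizedBelyi (d e₁ e₂ e₃ : ℕ) (N D : Poly) : Set where
  field
    coprime    : Σ Poly λ A → Σ Poly λ B → (A *ₚ N) +ₚ (B *ₚ D) ≈ₚ constₚ 1ℚ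
    degN       : DegreeIs N d
    degD       : DegreeIs D (d ∸ e₃)
    at0        : Σ Poly λ N₁ → (N ≈ₚ (X ^ₚ e₁) *ₚ N₁) × (eval N₁ 0ℚ ≢ 0ℚ)
    at1        : Σ Poly λ M →
                   (N -ₚ D ≈ₚ ((X -ₚ constₚ 1ℚ) ^ₚ e₂) *ₚ M) × (eval M 1ℚ ≢ 0ℚ)
    unramified : Σ ℚ λ c → (c ≢ 0ℚ) ×
                   ((deriv N *ₚ D) -ₚ (N *ₚ deriv D)
                     ≈ₚ c ·ₚ ((X ^ₚ (e₁ ∸ 1)) *ₚ ((X -ₚ constₚ 1ℚ) ^ₚ (e₂ ∸ 1))))

-- ∏_{lo ≤ j ≤ hi} f j   (empty product = 1 when hi < lo)
prodRange : ℕ → ℕ → (ℕ → ℕ) → ℕ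
prodRange lo hi f = List.foldr ℕ._*_ 1 (applyUpTo (λ t → f (lo ℕ.+ t)) (suc hi ∸ lo))

prodBelow : ℕ → (ℕ → ℕ) → ℕ
prodBelow i f = List.foldr ℕ._*_ 1 (applyUpTo f i)

coefA : ℕ → ℕ → ℕ → ℕ
coefA d k i = (k C i) ℕ.* prodRange (k ℕ.+ i ℕ.+ 1) (2 ℕ.* k) (λ j → d ∸ j)
                      ℕ.* prodBelow i (λ j → d ∸ j)

signed : ℕ → ℕ → ℚ
signed zero    n = ℕ→ℚ n
signed (suc i) n = ℚ.- signed i n

sumPoly : ℕ → (ℕ → ℚ) → (ℕ → ℕ) → Poly
sumPoly zero    c e = c 0 ·ₚ (X ^ₚ e 0)
sumPoly (suc n) c e = sumPoly n c e +ₚ (c (suc n) ·ₚ (X ^ₚ e (suc n)))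

belyiNum : ℕ → ℕ → Poly
belyiNum d k = (X ^ₚ (d ∸ k)) *ₚ sumPoly k (λ i → signed i (coefA d k i)) (λ i → k ∸ i)

belyiDen : ℕ → ℕ → Poly
belyiDen d k = sumPoly k (λ i → signed i (coefA d k i)) (λ i → i)

{-# OPTIONS --safe #-}
module Submission where

-- The a_i satisfy (i+1)(d-k-i-1) a_(i+1) = (d-i)(k-i) a_i, which makes D
-- and N two polynomial solutions of the hypergeometric equation
--   x(1-x) y'' + (c - (α+β+1) x) y' - αβ y = 0,   α = -k, β = -d, c = k+1-d.
-- By Abel's identity the Wronskian W = N'D - ND' solves the first-order equation
-- x(1-x) W' + (c - (α+β+1) x) W = 0, whose polynomial solutions are determined by
-- their coefficient of x^(d-k-1).  As x^(d-k-1) (x-1)^(2k) is one of them, W is a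
-- multiple of it, by the nonzero factor ±(d-k) a_k a_0: f = N/D is unramified away
-- from 0, 1 and ∞.  Since c - α - β - 1 = 2k, a solution vanishing at 1 vanishes
-- there to order > k = deg D, so D(1) ≠ 0; then N - D, which vanishes at 1, does so
-- to order exactly 2k+1 because (N-D)'D - (N-D)D' = W.  Finally D(0) D(1) ≠ 0 makes
-- D coprime to W, hence to N.

open import Algebra.Bundles using (CommutativeRing)
import Algebra.Solver.Ring
import Algebra.Solver.Ring.AlmostCommutativeRing as ACR
import Data.Integer as ℤ
import Data.Integer.Properties as ℤP
open import Data.List using ([]; _∷_; applyUpTo; drop; length)
open import Data.Maybe using (Maybe; just; nothing)
open import Data.Nat as ℕ using (ℕ; zero; suc; _≤_; _<_; z≤n; s≤s; _+_; _*_; _∸_; _!)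
open import Data.Nat.Combinatorics using (_C_; nCk+nC[k+1]≡[n+1]C[k+1]; nC1≡n; k>n⇒nCk≡0; nCk≡n!/k![n-k]!; k![n∸k]!∣n!)
open import Data.Nat.Coprimality using (1-coprimeTo) renaming (sym to coprime-sym)
open import Data.Nat.DivMod using (m/n*n≡m)
import Data.Nat.Properties as ℕP
open import Data.Nat.Solver using () renaming (module +-*-Solver to ℕ-Solver)
open import Data.Product using (Σ; _×_; _,_; proj₁; proj₂)
open import Data.Rational as ℚ using (ℚ; 0ℚ; 1ℚ; mkℚ; _/_)
import Data.Rational.Properties as ℚP
open import Data.Rational.Solver using () renaming (module +-*-Solver to ℚ-Solver)
open import Data.Sum using (inj₁; inj₂)
open import Function using (_∘_)
open import Level using (0ℓ)
open import Relation.Binary.Bundles using (Setoid)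
open import Relation.Binary.Definitions using (tri<; tri≈; tri>)
import Relation.Binary.Reasoning.Setoid as SetoidReasoning
open import Relation.Binary.Structures using (IsEquivalence)
open import Relation.Binary.PropositionalEquality
open import Relation.Nullary using (yes; no)
open import Defs

open ℕ-Solver using () renaming (solve to ℕ-solve; _:+_ to _⊞_; _:*_ to _⊠_; _:=_ to _≐_; con to ℕ-con)
open ℚ-Solver using (solve; _:+_; _:*_; _:-_; :-_; _:=_; con)

-- Binomial coefficients

prodBelow-suc : ∀ n f → prodBelow (suc n) f ≡ prodBelow n f * f n
prodBelow-suc zero    f = trans (ℕP.*-identityʳ (f 0)) (sym (ℕP.*-identityˡ (f 0)))
prodBelow-suc (suc n) f = trans (cong (f 0 *_) (prodBelow-suc n (λ t → f (suc t)))) (sym (ℕP.*-assoc (f 0) _ _))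

prodBelow-cong : ∀ n {f g} → (∀ t → f t ≡ g t) → prodBelow n f ≡ prodBelow n g
prodBelow-cong zero    f≡g = refl
prodBelow-cong (suc n) f≡g = cong₂ _*_ (f≡g 0) (prodBelow-cong n (λ t → f≡g (suc t)))

nC[i+1]*[i+1]≡nCi*[n∸i] : ∀ n i → (n C suc i) * suc i ≡ (n C i) * (n ∸ i)
nC[i+1]*[i+1]≡nCi*[n∸i] zero    i       = trans (cong (_* suc i) (k>n⇒nCk≡0 {0} {suc i} (s≤s z≤n)))
  (sym (trans (cong ((0 C i) *_) (ℕP.0∸n≡0 i)) (ℕP.*-zeroʳ (0 C i))))
nC[i+1]*[i+1]≡nCi*[n∸i] (suc n) zero    = trans (ℕP.*-identityʳ _) (trans (nC1≡n (suc n)) (sym (ℕP.*-identityˡ (suc n))))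
nC[i+1]*[i+1]≡nCi*[n∸i] (suc n) (suc j) = begin
  (suc n C suc (suc j)) * suc (suc j)                            ≡⟨ cong (_* suc (suc j)) (nCk+nC[k+1]≡[n+1]C[k+1] n (suc j)) ⟨
  (n C suc j + n C suc (suc j)) * suc (suc j)                    ≡⟨ ℕP.*-distribʳ-+ (suc (suc j)) (n C suc j) _ ⟩
  (n C suc j) * suc (suc j) + (n C suc (suc j)) * suc (suc j)    ≡⟨ cong ((n C suc j) * suc (suc j) +_) (nC[i+1]*[i+1]≡nCi*[n∸i] n (suc j)) ⟩
  (n C suc j) * suc (suc j) + (n C suc j) * (n ∸ suc j)          ≡⟨ ℕP.*-distribˡ-+ (n C suc j) _ _ ⟨
  (n C suc j) * (suc (suc j) + (n ∸ suc j))                      ≡⟨ regroup ⟩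
  (n C suc j) * (suc j + (n ∸ j))                                ≡⟨ ℕP.*-distribˡ-+ (n C suc j) _ _ ⟩
  (n C suc j) * suc j + (n C suc j) * (n ∸ j)                    ≡⟨ cong (_+ (n C suc j) * (n ∸ j)) (nC[i+1]*[i+1]≡nCi*[n∸i] n j) ⟩
  (n C j) * (n ∸ j) + (n C suc j) * (n ∸ j)                      ≡⟨ ℕP.*-distribʳ-+ (n ∸ j) (n C j) _ ⟨
  (n C j + n C suc j) * (n ∸ j)                                  ≡⟨ cong (_* (n ∸ j)) (nCk+nC[k+1]≡[n+1]C[k+1] n j) ⟩
  (suc n C suc j) * (suc n ∸ suc j)                              ∎
  where
  open ≡-Reasoning
  regroup : (n C suc j) * (suc (suc j) + (n ∸ suc j)) ≡ (n C suc j) * (suc j + (n ∸ j))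
  regroup with ℕP.≤-<-connex (suc j) n
  ... | inj₁ j<n = cong (λ m → (n C suc j) * suc m) (trans (ℕP.m+[n∸m]≡n j<n) (sym (ℕP.m+[n∸m]≡n (ℕP.<⇒≤ j<n))))
  ... | inj₂ n≤j = trans (cong (_* (suc (suc j) + (n ∸ suc j))) (k>n⇒nCk≡0 n≤j))
                         (sym (cong (_* (suc j + (n ∸ j))) (k>n⇒nCk≡0 n≤j)))

prodBelow-∸≡C*! : ∀ m n → prodBelow n (m ∸_) ≡ (m C n) * n !
prodBelow-∸≡C*! m zero    = refl
prodBelow-∸≡C*! m (suc n) = begin
  prodBelow (suc n) (m ∸_)           ≡⟨ prodBelow-suc n (m ∸_) ⟩
  prodBelow n (m ∸_) * (m ∸ n)       ≡⟨ cong (_* (m ∸ n)) (prodBelow-∸≡C*! m n) ⟩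
  (m C n) * n ! * (m ∸ n)            ≡⟨ ℕ-solve 3 (λ a b c → a ⊠ b ⊠ c ≐ a ⊠ c ⊠ b) refl (m C n) (n !) (m ∸ n) ⟩
  (m C n) * (m ∸ n) * n !            ≡⟨ cong (_* n !) (nC[i+1]*[i+1]≡nCi*[n∸i] m n) ⟨
  (m C suc n) * suc n * n !          ≡⟨ ℕP.*-assoc (m C suc n) (suc n) (n !) ⟩
  (m C suc n) * (suc n) !            ∎
  where open ≡-Reasoning

nCk*[k!*[n∸k]!]≡n! : ∀ {n k} → k ≤ n → (n C k) * (k ! * (n ∸ k) !) ≡ n !
nCk*[k!*[n∸k]!]≡n! {n} {k} k≤n =
  trans (cong (_* (k ! * (n ∸ k) !)) (nCk≡n!/k![n-k]! k≤n)) (m/n*n≡m (k![n∸k]!∣n! k≤n))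
  where instance _ = k ℕP.!* (n ∸ k) !≢0

nCk>0 : ∀ {n k} → k ≤ n → 0 < n C k
nCk>0 {n} {k} k≤n = ℕP.n≢0⇒n>0 λ nCk≡0 → ℕP.n>0⇒n≢0 (ℕP.1≤n! n)
  (trans (sym (nCk*[k!*[n∸k]!]≡n! k≤n)) (cong (_* (k ! * (n ∸ k) !)) nCk≡0))

*-pos : ∀ {m n} → 0 < m → 0 < n → 0 < m * n
*-pos {suc m} {suc n} _ _ = ℕP.0<1+n

module _ (d k : ℕ) where

  -- ∏_{k+i+1 ≤ j ≤ 2k} (d - j) is the falling factorial of length k - i from d - k - i - 1.
  top : ℕ → ℕ
  top i = d ∸ k ∸ i ∸ 1

  top≡ : ∀ i → top i ≡ d ∸ (k + i + 1)
  top≡ i = trans (cong (_∸ 1) (ℕP.∸-+-assoc d k i)) (ℕP.∸-+-assoc d (k + i) 1)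

  top-∸ : ∀ i t → top i ∸ t ≡ d ∸ (k + i + 1 + t)
  top-∸ i t = trans (cong (_∸ t) (top≡ i)) (ℕP.∸-+-assoc d (k + i + 1) t)

  2k+1≡[k+i+1]+[k∸i] : ∀ i → i ≤ k → 2 * k + 1 ≡ k + i + 1 + (k ∸ i)
  2k+1≡[k+i+1]+[k∸i] i i≤k = begin
    2 * k + 1                   ≡⟨ ℕ-solve 1 (λ k → ℕ-con 2 ⊠ k ⊞ ℕ-con 1 ≐ k ⊞ ℕ-con 1 ⊞ k) refl k ⟩
    k + 1 + k                   ≡⟨ cong (k + 1 +_) (ℕP.m+[n∸m]≡n i≤k) ⟨
    k + 1 + (i + (k ∸ i))       ≡⟨ ℕ-solve 3 (λ k i m → k ⊞ ℕ-con 1 ⊞ (i ⊞ m) ≐ k ⊞ i ⊞ ℕ-con 1 ⊞ m) refl k i (k ∸ i) ⟩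
    k + i + 1 + (k ∸ i)         ∎
    where open ≡-Reasoning

  prodRange≡falling : ∀ i → i ≤ k → prodRange (k + i + 1) (2 * k) (d ∸_) ≡ prodBelow (k ∸ i) (top i ∸_)
  prodRange≡falling i i≤k = begin
    prodBelow (suc (2 * k) ∸ (k + i + 1)) (λ t → d ∸ (k + i + 1 + t))   ≡⟨ cong (λ n → prodBelow n (λ t → d ∸ (k + i + 1 + t))) length≡ ⟩
    prodBelow (k ∸ i) (λ t → d ∸ (k + i + 1 + t))                       ≡⟨ prodBelow-cong (k ∸ i) (λ t → sym (top-∸ i t)) ⟩
    prodBelow (k ∸ i) (top i ∸_)                                        ∎
    where
    open ≡-Reasoning
    length≡ : suc (2 * k) ∸ (k + i + 1) ≡ k ∸ i
    length≡ = trans (cong (_∸ (k + i + 1)) (trans (ℕP.+-comm 1 (2 * k)) (2k+1≡[k+i+1]+[k∸i] i i≤k)))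
                    (ℕP.m+n∸m≡n (k + i + 1) (k ∸ i))

  coefA-closed-form : ∀ i → i ≤ k → coefA d k i ≡ k ! * (d C i) * (top i C (k ∸ i))
  coefA-closed-form i i≤k = begin
    (k C i) * prodRange (k + i + 1) (2 * k) (d ∸_) * prodBelow i (d ∸_)
      ≡⟨ cong₂ (λ u v → (k C i) * u * v) (trans (prodRange≡falling i i≤k) (prodBelow-∸≡C*! (top i) (k ∸ i))) (prodBelow-∸≡C*! d i) ⟩
    (k C i) * ((top i C (k ∸ i)) * (k ∸ i) !) * ((d C i) * i !)
      ≡⟨ ℕ-solve 6 (λ a b c e f g → a ⊠ (b ⊠ c) ⊠ (e ⊠ f) ≐ a ⊠ (f ⊠ c) ⊠ e ⊠ b)
                   refl (k C i) (top i C (k ∸ i)) ((k ∸ i) !) (d C i) (i !) (k !) ⟩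
    (k C i) * (i ! * (k ∸ i) !) * (d C i) * (top i C (k ∸ i))
      ≡⟨ cong (λ z → z * (d C i) * (top i C (k ∸ i))) (nCk*[k!*[n∸k]!]≡n! i≤k) ⟩
    k ! * (d C i) * (top i C (k ∸ i))
      ∎
    where open ≡-Reasoning

  coefA-pos : ∀ i → i ≤ k → 2 * k + 1 ≤ d → 0 < coefA d k i
  coefA-pos i i≤k 2k+1≤d rewrite coefA-closed-form i i≤k =
    *-pos (*-pos (ℕP.1≤n! k) (nCk>0 i≤d)) (nCk>0 k∸i≤top)
    where
    i≤d : i ≤ d
    i≤d = ℕP.≤-trans i≤k (ℕP.≤-trans (ℕP.m≤m+n k (k + 0)) (ℕP.≤-trans (ℕP.m≤m+n (2 * k) 1) 2k+1≤d))
    k∸i≤top : k ∸ i ≤ top i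
    k∸i≤top = subst (k ∸ i ≤_) (sym (top≡ i))
      (ℕP.m+n≤o⇒m≤o∸n (k ∸ i) (subst (_≤ d) (trans (2k+1≡[k+i+1]+[k∸i] i i≤k) (ℕP.+-comm (k + i + 1) (k ∸ i))) 2k+1≤d))

  coefA-zero : ∀ i → k < i → coefA d k i ≡ 0
  coefA-zero i k<i = cong (λ z → z * prodRange (k + i + 1) (2 * k) (d ∸_) * prodBelow i (d ∸_)) (k>n⇒nCk≡0 k<i)

  prodRange-step : ∀ i → i < k → prodRange (k + i + 1) (2 * k) (d ∸_) ≡ top i * prodRange (k + suc i + 1) (2 * k) (d ∸_)
  prodRange-step i i<k = begin
    prodRange (k + i + 1) (2 * k) (d ∸_)                   ≡⟨ prodRange≡falling i (ℕP.<⇒≤ i<k) ⟩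
    prodBelow (k ∸ i) (top i ∸_)                           ≡⟨ cong (λ n → prodBelow n (top i ∸_)) (ℕP.+-∸-assoc 1 i<k) ⟩
    top i * prodBelow (k ∸ suc i) (λ t → top i ∸ suc t)    ≡⟨ cong (top i *_) (prodBelow-cong (k ∸ suc i) shift) ⟩
    top i * prodBelow (k ∸ suc i) (top (suc i) ∸_)         ≡⟨ cong (top i *_) (prodRange≡falling (suc i) i<k) ⟨
    top i * prodRange (k + suc i + 1) (2 * k) (d ∸_)       ∎
    where
    open ≡-Reasoning
    shift : ∀ t → top i ∸ suc t ≡ top (suc i) ∸ t
    shift t = trans (top-∸ i (suc t))
      (trans (cong (d ∸_) (ℕ-solve 3 (λ k i t → k ⊞ i ⊞ ℕ-con 1 ⊞ (ℕ-con 1 ⊞ t) ≐ k ⊞ (ℕ-con 1 ⊞ i) ⊞ ℕ-con 1 ⊞ t) refl k i t))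
             (sym (top-∸ (suc i) t)))

  coefA-recurrence : ∀ i → i < k → coefA d k (suc i) * suc i * top i ≡ coefA d k i * (d ∸ i) * (k ∸ i)
  coefA-recurrence i i<k = begin
    (k C suc i) * Π′ * prodBelow (suc i) (d ∸_) * suc i * top i
      ≡⟨ cong (λ z → (k C suc i) * Π′ * z * suc i * top i) (prodBelow-suc i (d ∸_)) ⟩
    (k C suc i) * Π′ * (prodBelow i (d ∸_) * (d ∸ i)) * suc i * top i
      ≡⟨ ℕ-solve 6 (λ c r b x s m → c ⊠ r ⊠ (b ⊠ x) ⊠ s ⊠ m ≐ (c ⊠ s) ⊠ (m ⊠ r) ⊠ b ⊠ x)
             refl (k C suc i) Π′ (prodBelow i (d ∸_)) (d ∸ i) (suc i) (top i) ⟩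
    (k C suc i) * suc i * (top i * Π′) * prodBelow i (d ∸_) * (d ∸ i)
      ≡⟨ cong₂ (λ u v → u * v * prodBelow i (d ∸_) * (d ∸ i)) (nC[i+1]*[i+1]≡nCi*[n∸i] k i) (sym (prodRange-step i i<k)) ⟩
    (k C i) * (k ∸ i) * Π * prodBelow i (d ∸_) * (d ∸ i)
      ≡⟨ ℕ-solve 5 (λ c y r b x → c ⊠ y ⊠ r ⊠ b ⊠ x ≐ c ⊠ r ⊠ b ⊠ x ⊠ y) refl (k C i) (k ∸ i) Π (prodBelow i (d ∸_)) (d ∸ i) ⟩
    (k C i) * Π * prodBelow i (d ∸_) * (d ∸ i) * (k ∸ i)
      ∎
    where
    open ≡-Reasoning
    Π Π′ : ℕ
    Π  = prodRange (k + i + 1) (2 * k) (d ∸_)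
    Π′ = prodRange (k + suc i + 1) (2 * k) (d ∸_)

ℕ→ℚ≡mkℚ : ∀ n → ℕ→ℚ n ≡ mkℚ (ℤ.+ n) 0 (coprime-sym (1-coprimeTo n))
ℕ→ℚ≡mkℚ n = ℚP.normalize-coprime (coprime-sym (1-coprimeTo n))

ℕ→ℚ-homo-+ : ∀ m n → ℕ→ℚ (m + n) ≡ ℕ→ℚ m ℚ.+ ℕ→ℚ n
ℕ→ℚ-homo-+ m n = sym (begin
  ℕ→ℚ m ℚ.+ ℕ→ℚ n                  ≡⟨ cong₂ ℚ._+_ (ℕ→ℚ≡mkℚ m) (ℕ→ℚ≡mkℚ n) ⟩
  (ℤ.+ m ℤ.* ℤ.+ 1 ℤ.+ ℤ.+ n ℤ.* ℤ.+ 1) / 1  ≡⟨ cong (_/ 1) (cong₂ ℤ._+_ (ℤP.*-identityʳ (ℤ.+ m)) (ℤP.*-identityʳ (ℤ.+ n))) ⟩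
  ℕ→ℚ (m + n)                      ∎)
  where open ≡-Reasoning

ℕ→ℚ-homo-* : ∀ m n → ℕ→ℚ (m * n) ≡ ℕ→ℚ m ℚ.* ℕ→ℚ n
ℕ→ℚ-homo-* m n = sym (begin
  ℕ→ℚ m ℚ.* ℕ→ℚ n      ≡⟨ cong₂ ℚ._*_ (ℕ→ℚ≡mkℚ m) (ℕ→ℚ≡mkℚ n) ⟩
  (ℤ.+ m ℤ.* ℤ.+ n) / 1     ≡⟨ cong (_/ 1) (sym (ℤP.pos-* m n)) ⟩
  ℕ→ℚ (m * n)          ∎)
  where open ≡-Reasoning

ℕ→ℚ-homo-*³ : ∀ l m n → ℕ→ℚ (l * m * n) ≡ ℕ→ℚ l ℚ.* ℕ→ℚ m ℚ.* ℕ→ℚ n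
ℕ→ℚ-homo-*³ l m n = trans (ℕ→ℚ-homo-* (l * m) n) (cong (ℚ._* ℕ→ℚ n) (ℕ→ℚ-homo-* l m))

ℕ→ℚ-suc : ∀ n → ℕ→ℚ (suc n) ≡ 1ℚ ℚ.+ ℕ→ℚ n
ℕ→ℚ-suc = ℕ→ℚ-homo-+ 1

ℕ→ℚ-homo-∸ : ∀ {m n} → n ≤ m → ℕ→ℚ (m ∸ n) ≡ ℕ→ℚ m ℚ.- ℕ→ℚ n
ℕ→ℚ-homo-∸ {m} {n} n≤m = begin
  ℕ→ℚ (m ∸ n)                        ≡⟨ solve 2 (λ x y → x := x :+ y :- y) refl (ℕ→ℚ (m ∸ n)) (ℕ→ℚ n) ⟩
  ℕ→ℚ (m ∸ n) ℚ.+ ℕ→ℚ n ℚ.- ℕ→ℚ n  ≡⟨ cong (ℚ._- ℕ→ℚ n) (sym (ℕ→ℚ-homo-+ (m ∸ n) n)) ⟩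
  ℕ→ℚ (m ∸ n + n) ℚ.- ℕ→ℚ n          ≡⟨ cong (λ z → ℕ→ℚ z ℚ.- ℕ→ℚ n) (ℕP.m∸n+n≡m n≤m) ⟩
  ℕ→ℚ m ℚ.- ℕ→ℚ n                    ∎
  where open ≡-Reasoning

ℕ→ℚ-injective : ∀ {m n} → ℕ→ℚ m ≡ ℕ→ℚ n → m ≡ n
ℕ→ℚ-injective {m} {n} eq =
  ℤP.+-injective (cong ℚ.↥_ (trans (sym (ℕ→ℚ≡mkℚ m)) (trans eq (ℕ→ℚ≡mkℚ n))))

ℕ→ℚ-≢0 : ∀ {n} → n ≢ 0 → ℕ→ℚ n ≢ 0ℚ
ℕ→ℚ-≢0 n≢0 eq = n≢0 (ℕ→ℚ-injective eq)

x-y≡0⇒x≡y : ∀ {x y} → x ℚ.- y ≡ 0ℚ → x ≡ y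
x-y≡0⇒x≡y {x} {y} eq = begin
  x                ≡⟨ solve 2 (λ x y → x := (x :- y) :+ y) refl x y ⟩
  (x ℚ.- y) ℚ.+ y  ≡⟨ cong (ℚ._+ y) eq ⟩
  0ℚ ℚ.+ y         ≡⟨ ℚP.+-identityˡ y ⟩
  y                ∎
  where open ≡-Reasoning

x≡y⇒x-y≡0 : ∀ {x y} → x ≡ y → x ℚ.- y ≡ 0ℚ
x≡y⇒x-y≡0 {x} refl = ℚP.+-inverseʳ x

x*y≡0⇒y≡0 : ∀ {x y} → x ≢ 0ℚ → x ℚ.* y ≡ 0ℚ → y ≡ 0ℚ
x*y≡0⇒y≡0 {x} {y} x≢0 eq = begin
  y                      ≡⟨ sym (ℚP.*-identityˡ y) ⟩
  1ℚ ℚ.* y               ≡⟨ cong (ℚ._* y) (sym (ℚP.*-inverseˡ x)) ⟩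
  ℚ.1/ x ℚ.* x ℚ.* y     ≡⟨ ℚP.*-assoc (ℚ.1/ x) x y ⟩
  ℚ.1/ x ℚ.* (x ℚ.* y)   ≡⟨ cong (ℚ.1/ x ℚ.*_) eq ⟩
  ℚ.1/ x ℚ.* 0ℚ          ≡⟨ ℚP.*-zeroʳ (ℚ.1/ x) ⟩
  0ℚ                     ∎
  where
  open ≡-Reasoning
  instance _ = ℚ.≢-nonZero x≢0

*-≢0 : ∀ {x y} → x ≢ 0ℚ → y ≢ 0ℚ → x ℚ.* y ≢ 0ℚ
*-≢0 x≢0 y≢0 eq = y≢0 (x*y≡0⇒y≡0 x≢0 eq)

signed≡ : ∀ i n → signed i n ≡ signed i 1 ℚ.* ℕ→ℚ n
signed≡ zero    n = sym (ℚP.*-identityˡ (ℕ→ℚ n))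
signed≡ (suc i) n = trans (cong ℚ.-_ (signed≡ i n)) (ℚP.neg-distribˡ-* (signed i 1) (ℕ→ℚ n))

signed-0 : ∀ i → signed i 0 ≡ 0ℚ
signed-0 zero    = refl
signed-0 (suc i) = cong ℚ.-_ (signed-0 i)

signed-≢0 : ∀ i {n} → n ≢ 0 → signed i n ≢ 0ℚ
signed-≢0 zero    n≢0 = ℕ→ℚ-≢0 n≢0
signed-≢0 (suc i) n≢0 eq = signed-≢0 i n≢0 (ℚP.neg-injective eq)

-- The polynomial ring ℚ[x]

coeff-+ : ∀ p q n → coeff (p +ₚ q) n ≡ coeff p n ℚ.+ coeff q n
coeff-+ []      q       n       = sym (ℚP.+-identityˡ (coeff q n))
coeff-+ (a ∷ p) []      n       = sym (ℚP.+-identityʳ (coeff (a ∷ p) n))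
coeff-+ (a ∷ p) (b ∷ q) zero    = refl
coeff-+ (a ∷ p) (b ∷ q) (suc n) = coeff-+ p q n

coeff-· : ∀ c p n → coeff (c ·ₚ p) n ≡ c ℚ.* coeff p n
coeff-· c []      n       = sym (ℚP.*-zeroʳ c)
coeff-· c (a ∷ p) zero    = refl
coeff-· c (a ∷ p) (suc n) = coeff-· c p n

coeff-neg : ∀ p n → coeff (-ₚ p) n ≡ ℚ.- coeff p n
coeff-neg []      n       = refl
coeff-neg (a ∷ p) zero    = refl
coeff-neg (a ∷ p) (suc n) = coeff-neg p n

coeff-sub : ∀ p q n → coeff (p -ₚ q) n ≡ coeff p n ℚ.- coeff q n
coeff-sub p q n = trans (coeff-+ p (-ₚ q) n) (cong (coeff p n ℚ.+_) (coeff-neg q n))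

coeff-*-∷ : ∀ a p q n → coeff ((a ∷ p) *ₚ q) n ≡ a ℚ.* coeff q n ℚ.+ coeff (0ℚ ∷ p *ₚ q) n
coeff-*-∷ a p q n = trans (coeff-+ (a ·ₚ q) (0ℚ ∷ p *ₚ q) n) (cong (ℚ._+ coeff (0ℚ ∷ p *ₚ q) n) (coeff-· a q n))

convolution : (ℕ → ℚ) → (ℕ → ℚ) → ℕ → ℚ
convolution f g zero    = f 0 ℚ.* g 0
convolution f g (suc n) = f 0 ℚ.* g (suc n) ℚ.+ convolution (f ∘ suc) g n

convolution-cong : ∀ {f f′ g g′} → (∀ i → f i ≡ f′ i) → (∀ i → g i ≡ g′ i) →
                   ∀ n → convolution f g n ≡ convolution f′ g′ n
convolution-cong f≡ g≡ zero    = cong₂ ℚ._*_ (f≡ 0) (g≡ 0)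
convolution-cong f≡ g≡ (suc n) =
  cong₂ ℚ._+_ (cong₂ ℚ._*_ (f≡ 0) (g≡ (suc n))) (convolution-cong (f≡ ∘ suc) g≡ n)

convolution-zeroˡ : ∀ g n → convolution (λ _ → 0ℚ) g n ≡ 0ℚ
convolution-zeroˡ g zero    = ℚP.*-zeroˡ (g 0)
convolution-zeroˡ g (suc n) =
  trans (cong₂ ℚ._+_ (ℚP.*-zeroˡ (g (suc n))) (convolution-zeroˡ g n)) (ℚP.+-identityˡ 0ℚ)

coeff-* : ∀ p q n → coeff (p *ₚ q) n ≡ convolution (coeff p) (coeff q) n
coeff-* []      q n       = sym (convolution-zeroˡ (coeff q) n)
coeff-* (a ∷ p) q zero    = trans (coeff-*-∷ a p q 0) (ℚP.+-identityʳ _)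
coeff-* (a ∷ p) q (suc n) = trans (coeff-*-∷ a p q (suc n)) (cong (a ℚ.* coeff q (suc n) ℚ.+_) (coeff-* p q n))

-- Packing _≈ₚ_ into a record makes both polynomials inferable from a proof.
infix 4 _≋_
record _≋_ (p q : Poly) : Set where
  constructor mk≋
  field get : p ≈ₚ q
open _≋_ public

≋-refl : ∀ {p} → p ≋ p
≋-refl = mk≋ λ _ → refl

≋-sym : ∀ {p q} → p ≋ q → q ≋ p
≋-sym (mk≋ e) = mk≋ λ n → sym (e n)

≋-trans : ∀ {p q r} → p ≋ q → q ≋ r → p ≋ r
≋-trans (mk≋ e) (mk≋ f) = mk≋ λ n → trans (e n) (f n)

≡⇒≋ : ∀ {p q} → p ≡ q → p ≋ q
≡⇒≋ refl = ≋-refl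

≋-isEquivalence : IsEquivalence _≋_
≋-isEquivalence = record { refl = ≋-refl ; sym = ≋-sym ; trans = ≋-trans }

≋-setoid : Setoid 0ℓ 0ℓ
≋-setoid = record { isEquivalence = ≋-isEquivalence }

module ≋-Reasoning = SetoidReasoning ≋-setoid

constₚ-0 : constₚ 0ℚ ≋ []
constₚ-0 = mk≋ λ { zero → refl ; (suc n) → refl }

∷-cong : ∀ {a b p q} → a ≡ b → p ≋ q → a ∷ p ≋ b ∷ q
∷-cong a≡b (mk≋ p≈q) = mk≋ λ { zero → a≡b ; (suc n) → p≈q n }

∷-injectiveʳ : ∀ {a b p q} → a ∷ p ≋ b ∷ q → p ≋ q
∷-injectiveʳ (mk≋ e) = mk≋ (e ∘ suc)

∷≋[]⇒≋[] : ∀ {a p} → a ∷ p ≋ [] → p ≋ []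
∷≋[]⇒≋[] (mk≋ e) = mk≋ (e ∘ suc)

+ₚ-cong : ∀ {p p′ q q′} → p ≋ p′ → q ≋ q′ → p +ₚ q ≋ p′ +ₚ q′
+ₚ-cong {p} {p′} {q} {q′} (mk≋ e) (mk≋ f) =
  mk≋ λ n → trans (coeff-+ p q n) (trans (cong₂ ℚ._+_ (e n) (f n)) (sym (coeff-+ p′ q′ n)))

-ₚ-cong : ∀ {p p′} → p ≋ p′ → -ₚ p ≋ -ₚ p′
-ₚ-cong {p} {p′} (mk≋ e) =
  mk≋ λ n → trans (coeff-neg p n) (trans (cong ℚ.-_ (e n)) (sym (coeff-neg p′ n)))

·ₚ-congʳ : ∀ c {p p′} → p ≋ p′ → c ·ₚ p ≋ c ·ₚ p′
·ₚ-congʳ c {p} {p′} (mk≋ e) =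
  mk≋ λ n → trans (coeff-· c p n) (trans (cong (c ℚ.*_) (e n)) (sym (coeff-· c p′ n)))

*ₚ-cong : ∀ {p p′ q q′} → p ≋ p′ → q ≋ q′ → p *ₚ q ≋ p′ *ₚ q′
*ₚ-cong {p} {p′} {q} {q′} (mk≋ e) (mk≋ f) =
  mk≋ λ n → trans (coeff-* p q n) (trans (convolution-cong e f n) (sym (coeff-* p′ q′ n)))

+ₚ-congˡ : ∀ p {q q′} → q ≋ q′ → p +ₚ q ≋ p +ₚ q′
+ₚ-congˡ p = +ₚ-cong (≋-refl {p})

+ₚ-congʳ : ∀ {p p′} q → p ≋ p′ → p +ₚ q ≋ p′ +ₚ q
+ₚ-congʳ q e = +ₚ-cong e (≋-refl {q})

*ₚ-congˡ : ∀ p {q q′} → q ≋ q′ → p *ₚ q ≋ p *ₚ q′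
*ₚ-congˡ p = *ₚ-cong (≋-refl {p})

*ₚ-congʳ : ∀ {p p′} q → p ≋ p′ → p *ₚ q ≋ p′ *ₚ q
*ₚ-congʳ q e = *ₚ-cong e (≋-refl {q})

+ₚ-assoc : ∀ p q r → (p +ₚ q) +ₚ r ≋ p +ₚ (q +ₚ r)
+ₚ-assoc p q r = mk≋ λ n → begin
  coeff ((p +ₚ q) +ₚ r) n                   ≡⟨ coeff-+ (p +ₚ q) r n ⟩
  coeff (p +ₚ q) n ℚ.+ coeff r n            ≡⟨ cong (ℚ._+ coeff r n) (coeff-+ p q n) ⟩
  coeff p n ℚ.+ coeff q n ℚ.+ coeff r n     ≡⟨ ℚP.+-assoc (coeff p n) _ _ ⟩
  coeff p n ℚ.+ (coeff q n ℚ.+ coeff r n)   ≡⟨ cong (coeff p n ℚ.+_) (coeff-+ q r n) ⟨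
  coeff p n ℚ.+ coeff (q +ₚ r) n            ≡⟨ coeff-+ p (q +ₚ r) n ⟨
  coeff (p +ₚ (q +ₚ r)) n                   ∎
  where open ≡-Reasoning

+ₚ-comm : ∀ p q → p +ₚ q ≋ q +ₚ p
+ₚ-comm p q = mk≋ λ n → trans (coeff-+ p q n) (trans (ℚP.+-comm (coeff p n) _) (sym (coeff-+ q p n)))

+ₚ-identityʳ : ∀ p → p +ₚ [] ≋ p
+ₚ-identityʳ p = mk≋ λ n → trans (coeff-+ p [] n) (ℚP.+-identityʳ _)

-ₚ-inverseˡ : ∀ p → (-ₚ p) +ₚ p ≋ []
-ₚ-inverseˡ p = mk≋ λ n →
  trans (coeff-+ (-ₚ p) p n) (trans (cong (ℚ._+ coeff p n) (coeff-neg p n)) (ℚP.+-inverseˡ (coeff p n)))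

-ₚ-inverseʳ : ∀ p → p +ₚ (-ₚ p) ≋ []
-ₚ-inverseʳ p = ≋-trans (+ₚ-comm p (-ₚ p)) (-ₚ-inverseˡ p)

*ₚ-zeroʳ : ∀ p → p *ₚ [] ≋ []
*ₚ-zeroʳ []      = ≋-refl
*ₚ-zeroʳ (a ∷ p) = mk≋ λ { zero → refl ; (suc n) → get (*ₚ-zeroʳ p) n }

0∷-*ₚ : ∀ p q → (0ℚ ∷ p) *ₚ q ≋ 0ℚ ∷ p *ₚ q
0∷-*ₚ p q = mk≋ λ n → trans (coeff-*-∷ 0ℚ p q n)
  (trans (cong (ℚ._+ coeff (0ℚ ∷ p *ₚ q) n) (ℚP.*-zeroˡ (coeff q n))) (ℚP.+-identityˡ _))

*ₚ-distribʳ : ∀ p q r → (p +ₚ q) *ₚ r ≋ p *ₚ r +ₚ q *ₚ r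
*ₚ-distribʳ []      q       r = ≋-refl
*ₚ-distribʳ (a ∷ p) []      r = ≋-sym (+ₚ-identityʳ _)
*ₚ-distribʳ (a ∷ p) (b ∷ q) r = mk≋ λ n → begin
  coeff (((a ℚ.+ b) ∷ p +ₚ q) *ₚ r) n
    ≡⟨ coeff-*-∷ (a ℚ.+ b) (p +ₚ q) r n ⟩
  (a ℚ.+ b) ℚ.* coeff r n ℚ.+ coeff (0ℚ ∷ (p +ₚ q) *ₚ r) n
    ≡⟨ cong ((a ℚ.+ b) ℚ.* coeff r n ℚ.+_) (trans (get tail n) (coeff-+ (0ℚ ∷ p *ₚ r) (0ℚ ∷ q *ₚ r) n)) ⟩
  (a ℚ.+ b) ℚ.* coeff r n ℚ.+ (coeff (0ℚ ∷ p *ₚ r) n ℚ.+ coeff (0ℚ ∷ q *ₚ r) n)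
    ≡⟨ solve 5 (λ a b r x y → (a :+ b) :* r :+ (x :+ y) := a :* r :+ x :+ (b :* r :+ y)) refl
               a b (coeff r n) (coeff (0ℚ ∷ p *ₚ r) n) (coeff (0ℚ ∷ q *ₚ r) n) ⟩
  (a ℚ.* coeff r n ℚ.+ coeff (0ℚ ∷ p *ₚ r) n) ℚ.+ (b ℚ.* coeff r n ℚ.+ coeff (0ℚ ∷ q *ₚ r) n)
    ≡⟨ cong₂ ℚ._+_ (coeff-*-∷ a p r n) (coeff-*-∷ b q r n) ⟨
  coeff ((a ∷ p) *ₚ r) n ℚ.+ coeff ((b ∷ q) *ₚ r) n
    ≡⟨ coeff-+ ((a ∷ p) *ₚ r) ((b ∷ q) *ₚ r) n ⟨
  coeff ((a ∷ p) *ₚ r +ₚ (b ∷ q) *ₚ r) n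
    ∎
  where
  open ≡-Reasoning
  tail : 0ℚ ∷ (p +ₚ q) *ₚ r ≋ (0ℚ ∷ p *ₚ r) +ₚ (0ℚ ∷ q *ₚ r)
  tail = ∷-cong (sym (ℚP.+-identityˡ 0ℚ)) (*ₚ-distribʳ p q r)

·ₚ-*ₚ-assoc : ∀ c p q → (c ·ₚ p) *ₚ q ≋ c ·ₚ (p *ₚ q)
·ₚ-*ₚ-assoc c []      q = ≋-refl
·ₚ-*ₚ-assoc c (a ∷ p) q = mk≋ λ n → begin
  coeff ((c ℚ.* a ∷ c ·ₚ p) *ₚ q) n
    ≡⟨ coeff-*-∷ (c ℚ.* a) (c ·ₚ p) q n ⟩
  c ℚ.* a ℚ.* coeff q n ℚ.+ coeff (0ℚ ∷ (c ·ₚ p) *ₚ q) n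
    ≡⟨ cong (c ℚ.* a ℚ.* coeff q n ℚ.+_) (trans (get tail n) (coeff-· c (0ℚ ∷ p *ₚ q) n)) ⟩
  c ℚ.* a ℚ.* coeff q n ℚ.+ c ℚ.* coeff (0ℚ ∷ p *ₚ q) n
    ≡⟨ solve 4 (λ c a x y → c :* a :* x :+ c :* y := c :* (a :* x :+ y)) refl c a (coeff q n) (coeff (0ℚ ∷ p *ₚ q) n) ⟩
  c ℚ.* (a ℚ.* coeff q n ℚ.+ coeff (0ℚ ∷ p *ₚ q) n)
    ≡⟨ cong (c ℚ.*_) (coeff-*-∷ a p q n) ⟨
  c ℚ.* coeff ((a ∷ p) *ₚ q) n
    ≡⟨ coeff-· c ((a ∷ p) *ₚ q) n ⟨
  coeff (c ·ₚ ((a ∷ p) *ₚ q)) n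
    ∎
  where
  open ≡-Reasoning
  tail : 0ℚ ∷ (c ·ₚ p) *ₚ q ≋ c ·ₚ (0ℚ ∷ p *ₚ q)
  tail = ∷-cong (sym (ℚP.*-zeroʳ c)) (·ₚ-*ₚ-assoc c p q)

*ₚ-∷ʳ : ∀ p b q → p *ₚ (b ∷ q) ≋ b ·ₚ p +ₚ (0ℚ ∷ p *ₚ q)
*ₚ-∷ʳ []      b q = mk≋ λ { zero → sym (ℚP.+-identityˡ 0ℚ) ; (suc n) → refl }
*ₚ-∷ʳ (a ∷ p) b q = mk≋ λ n → begin
  coeff ((a ∷ p) *ₚ (b ∷ q)) n
    ≡⟨ coeff-*-∷ a p (b ∷ q) n ⟩
  a ℚ.* coeff (b ∷ q) n ℚ.+ coeff (0ℚ ∷ p *ₚ (b ∷ q)) n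
    ≡⟨ swap n ⟩
  b ℚ.* coeff (a ∷ p) n ℚ.+ coeff (0ℚ ∷ (a ∷ p) *ₚ q) n
    ≡⟨ cong (ℚ._+ coeff (0ℚ ∷ (a ∷ p) *ₚ q) n) (coeff-· b (a ∷ p) n) ⟨
  coeff (b ·ₚ (a ∷ p)) n ℚ.+ coeff (0ℚ ∷ (a ∷ p) *ₚ q) n
    ≡⟨ coeff-+ (b ·ₚ (a ∷ p)) (0ℚ ∷ (a ∷ p) *ₚ q) n ⟨
  coeff (b ·ₚ (a ∷ p) +ₚ (0ℚ ∷ (a ∷ p) *ₚ q)) n
    ∎
  where
  open ≡-Reasoning
  swap : ∀ n → a ℚ.* coeff (b ∷ q) n ℚ.+ coeff (0ℚ ∷ p *ₚ (b ∷ q)) n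
             ≡ b ℚ.* coeff (a ∷ p) n ℚ.+ coeff (0ℚ ∷ (a ∷ p) *ₚ q) n
  swap zero    = cong (ℚ._+ 0ℚ) (ℚP.*-comm a b)
  swap (suc m) = begin
    a ℚ.* coeff q m ℚ.+ coeff (p *ₚ (b ∷ q)) m
      ≡⟨ cong (a ℚ.* coeff q m ℚ.+_) (trans (get (*ₚ-∷ʳ p b q) m) (coeff-+ (b ·ₚ p) (0ℚ ∷ p *ₚ q) m)) ⟩
    a ℚ.* coeff q m ℚ.+ (coeff (b ·ₚ p) m ℚ.+ coeff (0ℚ ∷ p *ₚ q) m)
      ≡⟨ cong (λ z → a ℚ.* coeff q m ℚ.+ (z ℚ.+ coeff (0ℚ ∷ p *ₚ q) m)) (coeff-· b p m) ⟩
    a ℚ.* coeff q m ℚ.+ (b ℚ.* coeff p m ℚ.+ coeff (0ℚ ∷ p *ₚ q) m)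
      ≡⟨ solve 5 (λ a x b y z → a :* x :+ (b :* y :+ z) := b :* y :+ (a :* x :+ z)) refl
                 a (coeff q m) b (coeff p m) (coeff (0ℚ ∷ p *ₚ q) m) ⟩
    b ℚ.* coeff p m ℚ.+ (a ℚ.* coeff q m ℚ.+ coeff (0ℚ ∷ p *ₚ q) m)
      ≡⟨ cong (b ℚ.* coeff p m ℚ.+_) (coeff-*-∷ a p q m) ⟨
    b ℚ.* coeff p m ℚ.+ coeff ((a ∷ p) *ₚ q) m
      ∎

*ₚ-comm : ∀ p q → p *ₚ q ≋ q *ₚ p
*ₚ-comm []      q = ≋-sym (*ₚ-zeroʳ q)
*ₚ-comm (a ∷ p) q = ≋-trans (+ₚ-congˡ (a ·ₚ q) (∷-cong refl (*ₚ-comm p q))) (≋-sym (*ₚ-∷ʳ q a p))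

*ₚ-assoc : ∀ p q r → (p *ₚ q) *ₚ r ≋ p *ₚ (q *ₚ r)
*ₚ-assoc []      q r = ≋-refl
*ₚ-assoc (a ∷ p) q r = ≋-trans (*ₚ-distribʳ (a ·ₚ q) (0ℚ ∷ p *ₚ q) r)
  (+ₚ-cong (·ₚ-*ₚ-assoc a q r) (≋-trans (0∷-*ₚ (p *ₚ q) r) (∷-cong refl (*ₚ-assoc p q r))))

*ₚ-identityˡ : ∀ p → constₚ 1ℚ *ₚ p ≋ p
*ₚ-identityˡ p = mk≋ λ n → trans (coeff-*-∷ 1ℚ [] p n)
  (trans (cong₂ ℚ._+_ (ℚP.*-identityˡ (coeff p n)) (get constₚ-0 n)) (ℚP.+-identityʳ _))

*ₚ-identityʳ : ∀ p → p *ₚ constₚ 1ℚ ≋ p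
*ₚ-identityʳ p = ≋-trans (*ₚ-comm p (constₚ 1ℚ)) (*ₚ-identityˡ p)

*ₚ-distribˡ : ∀ p q r → p *ₚ (q +ₚ r) ≋ p *ₚ q +ₚ p *ₚ r
*ₚ-distribˡ p q r = ≋-trans (*ₚ-comm p (q +ₚ r))
  (≋-trans (*ₚ-distribʳ q r p) (+ₚ-cong (*ₚ-comm q p) (*ₚ-comm r p)))

ℚ[x] : CommutativeRing 0ℓ 0ℓ
ℚ[x] = record
  { Carrier = Poly ; _≈_ = _≋_ ; _+_ = _+ₚ_ ; _*_ = _*ₚ_ ; -_ = -ₚ_ ; 0# = [] ; 1# = constₚ 1ℚ
  ; isCommutativeRing = record
    { isRing = record
      { +-isAbelianGroup = record
        { isGroup = record
          { isMonoid = record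
            { isSemigroup = record
              { isMagma = record { isEquivalence = ≋-isEquivalence ; ∙-cong = +ₚ-cong }
              ; assoc = +ₚ-assoc }
            ; identity = (λ _ → ≋-refl) , +ₚ-identityʳ }
          ; inverse = -ₚ-inverseˡ , -ₚ-inverseʳ
          ; ⁻¹-cong = -ₚ-cong }
        ; comm = +ₚ-comm }
      ; *-cong = *ₚ-cong
      ; *-assoc = *ₚ-assoc
      ; *-identity = *ₚ-identityˡ , *ₚ-identityʳ
      ; distrib = *ₚ-distribˡ , (λ r p q → *ₚ-distribʳ p q r) }
    ; *-comm = *ₚ-comm } }

constₚ-homo-* : ∀ a b → constₚ (a ℚ.* b) ≋ constₚ a *ₚ constₚ b
constₚ-homo-* a b = mk≋ λ { zero → sym (ℚP.+-identityʳ (a ℚ.* b)) ; (suc n) → refl }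

constₚ-homomorphism : ACR._-Raw-AlmostCommutative⟶_ ℚP.+-*-rawRing (ACR.fromCommutativeRing ℚ[x])
constₚ-homomorphism = record
  { ⟦_⟧ = constₚ ; +-homo = λ _ _ → ≋-refl ; *-homo = constₚ-homo-* ; -‿homo = λ _ → ≋-refl
  ; 0-homo = constₚ-0 ; 1-homo = ≋-refl }

constₚ-≟ : (a b : ℚ) → Maybe (constₚ a ≋ constₚ b)
constₚ-≟ a b with a ℚP.≟ b
... | yes refl = just ≋-refl
... | no _     = nothing

module ℚ[x]-Solver =
  Algebra.Solver.Ring ℚP.+-*-rawRing (ACR.fromCommutativeRing ℚ[x]) constₚ-homomorphism constₚ-≟

open ℚ[x]-Solver using () renaming (solve to psolve; _:+_ to _⊕_; _:*_ to _⊗_; _:-_ to _⊖_; :-_ to ⊝_; _:=_ to _⊜_; con to κ)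

X-*ₚ : ∀ p → X *ₚ p ≋ 0ℚ ∷ p
X-*ₚ p = mk≋ λ n → trans (coeff-*-∷ 0ℚ (1ℚ ∷ []) p n)
  (trans (cong (ℚ._+ coeff (0ℚ ∷ constₚ 1ℚ *ₚ p) n) (ℚP.*-zeroˡ (coeff p n)))
  (trans (ℚP.+-identityˡ _) (get (∷-cong refl (*ₚ-identityˡ p)) n)))

∷≋constₚ+X*ₚ : ∀ a p → a ∷ p ≋ constₚ a +ₚ X *ₚ p
∷≋constₚ+X*ₚ a p = ≋-sym (≋-trans (+ₚ-congˡ (constₚ a) (X-*ₚ p))
                                   (mk≋ λ { zero → ℚP.+-identityʳ a ; (suc n) → refl }))

p≋X*drop1+p₀ : ∀ p → p ≋ X *ₚ drop 1 p +ₚ constₚ (coeff p 0)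
p≋X*drop1+p₀ []      = ≋-sym (+ₚ-cong (*ₚ-zeroʳ X) constₚ-0)
p≋X*drop1+p₀ (a ∷ p) = ≋-trans (∷≋constₚ+X*ₚ a p) (+ₚ-comm (constₚ a) (X *ₚ p))

·ₚ-X-*ₚ : ∀ c p → c ·ₚ (X *ₚ p) ≋ 0ℚ ∷ c ·ₚ p
·ₚ-X-*ₚ c p = ≋-trans (·ₚ-congʳ c (X-*ₚ p)) (∷-cong (ℚP.*-zeroʳ c) ≋-refl)

·ₚ≋constₚ-*ₚ : ∀ c p → c ·ₚ p ≋ constₚ c *ₚ p
·ₚ≋constₚ-*ₚ c p = mk≋ λ n → sym (trans (coeff-*-∷ c [] p n)
  (trans (cong (c ℚ.* coeff p n ℚ.+_) (get constₚ-0 n)) (trans (ℚP.+-identityʳ _) (sym (coeff-· c p n)))))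

p-q≋0⇒p≋q : ∀ p q → p -ₚ q ≋ [] → p ≋ q
p-q≋0⇒p≋q p q p-q≋0 = begin
  p                 ≈⟨ psolve 2 (λ p q → p ⊜ (p ⊖ q) ⊕ q) ≋-refl p q ⟩
  (p -ₚ q) +ₚ q     ≈⟨ +ₚ-congʳ q p-q≋0 ⟩
  q                 ∎
  where open ≋-Reasoning

^ₚ-+ : ∀ p m n → p ^ₚ (m + n) ≋ p ^ₚ m *ₚ p ^ₚ n
^ₚ-+ p zero    n = ≋-sym (*ₚ-identityˡ (p ^ₚ n))
^ₚ-+ p (suc m) n = ≋-trans (*ₚ-congˡ p (^ₚ-+ p m n)) (≋-sym (*ₚ-assoc p (p ^ₚ m) (p ^ₚ n)))

natₚ : ℕ → Poly
natₚ n = constₚ (ℕ→ℚ n)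

natₚ-suc : ∀ n → natₚ (suc n) ≋ constₚ 1ℚ +ₚ natₚ n
natₚ-suc n = mk≋ λ { zero → ℕ→ℚ-suc n ; (suc m) → refl }

eval-≋[] : ∀ {p} x → p ≋ [] → eval p x ≡ 0ℚ
eval-≋[] {[]}    x p≋0 = refl
eval-≋[] {a ∷ p} x p≋0 = begin
  a ℚ.+ x ℚ.* eval p x   ≡⟨ cong₂ (λ u v → u ℚ.+ x ℚ.* v) (get p≋0 0) (eval-≋[] x (∷≋[]⇒≋[] p≋0)) ⟩
  0ℚ ℚ.+ x ℚ.* 0ℚ        ≡⟨ solve 1 (λ x → con 0ℚ :+ x :* con 0ℚ := con 0ℚ) refl x ⟩
  0ℚ                     ∎
  where open ≡-Reasoning

eval-cong : ∀ x {p q} → p ≋ q → eval p x ≡ eval q x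
eval-cong x {[]}    {q}     p≋q = sym (eval-≋[] x (≋-sym p≋q))
eval-cong x {a ∷ p} {[]}    p≋q = eval-≋[] x p≋q
eval-cong x {a ∷ p} {b ∷ q} p≋q =
  cong₂ (λ u v → u ℚ.+ x ℚ.* v) (get p≋q 0) (eval-cong x (∷-injectiveʳ p≋q))

eval-+ : ∀ p q x → eval (p +ₚ q) x ≡ eval p x ℚ.+ eval q x
eval-+ []      q       x = sym (ℚP.+-identityˡ _)
eval-+ (a ∷ p) []      x = sym (ℚP.+-identityʳ _)
eval-+ (a ∷ p) (b ∷ q) x = begin
  a ℚ.+ b ℚ.+ x ℚ.* eval (p +ₚ q) x               ≡⟨ cong (λ v → a ℚ.+ b ℚ.+ x ℚ.* v) (eval-+ p q x) ⟩
  a ℚ.+ b ℚ.+ x ℚ.* (eval p x ℚ.+ eval q x)       ≡⟨ solve 5 (λ a b x u v → a :+ b :+ x :* (u :+ v) := a :+ x :* u :+ (b :+ x :* v))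
                                                       refl a b x (eval p x) (eval q x) ⟩
  a ℚ.+ x ℚ.* eval p x ℚ.+ (b ℚ.+ x ℚ.* eval q x) ∎
  where open ≡-Reasoning

eval-· : ∀ c p x → eval (c ·ₚ p) x ≡ c ℚ.* eval p x
eval-· c []      x = sym (ℚP.*-zeroʳ c)
eval-· c (a ∷ p) x = begin
  c ℚ.* a ℚ.+ x ℚ.* eval (c ·ₚ p) x    ≡⟨ cong (λ v → c ℚ.* a ℚ.+ x ℚ.* v) (eval-· c p x) ⟩
  c ℚ.* a ℚ.+ x ℚ.* (c ℚ.* eval p x)   ≡⟨ solve 4 (λ c a x u → c :* a :+ x :* (c :* u) := c :* (a :+ x :* u)) refl c a x (eval p x) ⟩
  c ℚ.* (a ℚ.+ x ℚ.* eval p x)         ∎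
  where open ≡-Reasoning

eval-neg : ∀ p x → eval (-ₚ p) x ≡ ℚ.- eval p x
eval-neg []      x = refl
eval-neg (a ∷ p) x = begin
  ℚ.- a ℚ.+ x ℚ.* eval (-ₚ p) x     ≡⟨ cong (λ v → ℚ.- a ℚ.+ x ℚ.* v) (eval-neg p x) ⟩
  ℚ.- a ℚ.+ x ℚ.* (ℚ.- eval p x)    ≡⟨ solve 3 (λ a x u → :- a :+ x :* (:- u) := :- (a :+ x :* u)) refl a x (eval p x) ⟩
  ℚ.- (a ℚ.+ x ℚ.* eval p x)        ∎
  where open ≡-Reasoning

eval-sub : ∀ p q x → eval (p -ₚ q) x ≡ eval p x ℚ.- eval q x
eval-sub p q x = trans (eval-+ p (-ₚ q) x) (cong (eval p x ℚ.+_) (eval-neg q x))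

eval-* : ∀ p q x → eval (p *ₚ q) x ≡ eval p x ℚ.* eval q x
eval-* []      q x = sym (ℚP.*-zeroˡ (eval q x))
eval-* (a ∷ p) q x = begin
  eval (a ·ₚ q +ₚ (0ℚ ∷ p *ₚ q)) x
    ≡⟨ eval-+ (a ·ₚ q) (0ℚ ∷ p *ₚ q) x ⟩
  eval (a ·ₚ q) x ℚ.+ (0ℚ ℚ.+ x ℚ.* eval (p *ₚ q) x)
    ≡⟨ cong₂ (λ u v → u ℚ.+ (0ℚ ℚ.+ x ℚ.* v)) (eval-· a q x) (eval-* p q x) ⟩
  a ℚ.* eval q x ℚ.+ (0ℚ ℚ.+ x ℚ.* (eval p x ℚ.* eval q x))
    ≡⟨ solve 4 (λ a x u v → a :* v :+ (con 0ℚ :+ x :* (u :* v)) := (a :+ x :* u) :* v) refl a x (eval p x) (eval q x) ⟩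
  (a ℚ.+ x ℚ.* eval p x) ℚ.* eval q x
    ∎
  where open ≡-Reasoning

eval-constₚ : ∀ c x → eval (constₚ c) x ≡ c
eval-constₚ c x = trans (cong (c ℚ.+_) (ℚP.*-zeroʳ x)) (ℚP.+-identityʳ c)

eval-X : ∀ x → eval X x ≡ x
eval-X x = solve 1 (λ x → con 0ℚ :+ x :* (con 1ℚ :+ x :* con 0ℚ) := x) refl x

eval-^ₚ-1 : ∀ {p x} → eval p x ≡ 1ℚ → ∀ n → eval (p ^ₚ n) x ≡ 1ℚ
eval-^ₚ-1 {p} {x} p[x]≡1 zero    = eval-constₚ 1ℚ x
eval-^ₚ-1 {p} {x} p[x]≡1 (suc n) = trans (eval-* p (p ^ₚ n) x) (cong₂ ℚ._*_ p[x]≡1 (eval-^ₚ-1 {p} {x} p[x]≡1 n))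

eval-^ₚ-2* : ∀ {p x} → eval p x ℚ.* eval p x ≡ 1ℚ → ∀ n → eval (p ^ₚ (2 * n)) x ≡ 1ℚ
eval-^ₚ-2* {p} {x} p[x]²≡1 zero    = eval-constₚ 1ℚ x
eval-^ₚ-2* {p} {x} p[x]²≡1 (suc n) = subst (λ m → eval (p ^ₚ m) x ≡ 1ℚ) (sym (ℕP.*-suc 2 n)) (begin
  eval (p *ₚ (p *ₚ p ^ₚ (2 * n))) x                  ≡⟨ eval-* p (p *ₚ p ^ₚ (2 * n)) x ⟩
  eval p x ℚ.* eval (p *ₚ p ^ₚ (2 * n)) x            ≡⟨ cong (eval p x ℚ.*_) (eval-* p (p ^ₚ (2 * n)) x) ⟩
  eval p x ℚ.* (eval p x ℚ.* eval (p ^ₚ (2 * n)) x)  ≡⟨ cong (λ v → eval p x ℚ.* (eval p x ℚ.* v)) (eval-^ₚ-2* {p} {x} p[x]²≡1 n) ⟩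
  eval p x ℚ.* (eval p x ℚ.* 1ℚ)                     ≡⟨ cong (eval p x ℚ.*_) (ℚP.*-identityʳ (eval p x)) ⟩
  eval p x ℚ.* eval p x                              ≡⟨ p[x]²≡1 ⟩
  1ℚ                                                 ∎)
  where open ≡-Reasoning

eval-0 : ∀ p → eval p 0ℚ ≡ coeff p 0
eval-0 []      = refl
eval-0 (a ∷ p) = trans (cong (a ℚ.+_) (ℚP.*-zeroˡ (eval p 0ℚ))) (ℚP.+-identityʳ a)

-- The formal derivative and the Wronskian

derivFrom : ℕ → Poly → Poly
derivFrom _ []      = []
derivFrom k (c ∷ q) = (ℕ→ℚ k ℚ.* c) ∷ derivFrom (suc k) q

-- Defs.deriv is computed by a where-bound worker that cannot be named here.  The
-- `with` in deriv-∷≡derivFrom abstracts its arguments, so that the underscore is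
-- solved by unification as that worker.
worker≡derivFrom : (a : ℚ) (p : Poly) (k : ℕ) (q : Poly) → _ ≡ derivFrom k q

deriv-∷≡derivFrom : ∀ a p → deriv (a ∷ p) ≡ derivFrom 1 p
deriv-∷≡derivFrom a []      = refl
deriv-∷≡derivFrom a (b ∷ q) with b ∷ q | 2
... | p | k = cong (_ ∷_) (worker≡derivFrom a p k q)

worker≡derivFrom a p k []      = refl
worker≡derivFrom a p k (c ∷ q) = cong (_ ∷_) (worker≡derivFrom a p (suc k) q)

coeff-derivFrom : ∀ k q n → coeff (derivFrom k q) n ≡ ℕ→ℚ (k + n) ℚ.* coeff q n
coeff-derivFrom k []      n       = sym (ℚP.*-zeroʳ (ℕ→ℚ (k + n)))
coeff-derivFrom k (c ∷ q) zero    rewrite ℕP.+-identityʳ k = refl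
coeff-derivFrom k (c ∷ q) (suc n) rewrite ℕP.+-suc k n     = coeff-derivFrom (suc k) q n

coeff-deriv : ∀ p n → coeff (deriv p) n ≡ ℕ→ℚ (suc n) ℚ.* coeff p (suc n)
coeff-deriv []      n = sym (ℚP.*-zeroʳ (ℕ→ℚ (suc n)))
coeff-deriv (a ∷ p) n rewrite deriv-∷≡derivFrom a p = coeff-derivFrom 1 p n

deriv-cong : ∀ {p q} → p ≋ q → deriv p ≋ deriv q
deriv-cong {p} {q} (mk≋ p≈q) = mk≋ λ n →
  trans (coeff-deriv p n) (trans (cong (ℕ→ℚ (suc n) ℚ.*_) (p≈q (suc n))) (sym (coeff-deriv q n)))

deriv-+ : ∀ p q → deriv (p +ₚ q) ≋ deriv p +ₚ deriv q
deriv-+ p q = mk≋ λ n → begin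
  coeff (deriv (p +ₚ q)) n                                               ≡⟨ coeff-deriv (p +ₚ q) n ⟩
  ℕ→ℚ (suc n) ℚ.* coeff (p +ₚ q) (suc n)                                 ≡⟨ cong (ℕ→ℚ (suc n) ℚ.*_) (coeff-+ p q (suc n)) ⟩
  ℕ→ℚ (suc n) ℚ.* (coeff p (suc n) ℚ.+ coeff q (suc n))                  ≡⟨ ℚP.*-distribˡ-+ (ℕ→ℚ (suc n)) _ _ ⟩
  ℕ→ℚ (suc n) ℚ.* coeff p (suc n) ℚ.+ ℕ→ℚ (suc n) ℚ.* coeff q (suc n)   ≡⟨ cong₂ ℚ._+_ (coeff-deriv p n) (coeff-deriv q n) ⟨
  coeff (deriv p) n ℚ.+ coeff (deriv q) n                                ≡⟨ coeff-+ (deriv p) (deriv q) n ⟨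
  coeff (deriv p +ₚ deriv q) n                                           ∎
  where open ≡-Reasoning

deriv-· : ∀ c p → deriv (c ·ₚ p) ≋ c ·ₚ deriv p
deriv-· c p = mk≋ λ n → begin
  coeff (deriv (c ·ₚ p)) n                      ≡⟨ coeff-deriv (c ·ₚ p) n ⟩
  ℕ→ℚ (suc n) ℚ.* coeff (c ·ₚ p) (suc n)        ≡⟨ cong (ℕ→ℚ (suc n) ℚ.*_) (coeff-· c p (suc n)) ⟩
  ℕ→ℚ (suc n) ℚ.* (c ℚ.* coeff p (suc n))       ≡⟨ solve 3 (λ a c x → a :* (c :* x) := c :* (a :* x)) refl (ℕ→ℚ (suc n)) c (coeff p (suc n)) ⟩
  c ℚ.* (ℕ→ℚ (suc n) ℚ.* coeff p (suc n))       ≡⟨ cong (c ℚ.*_) (coeff-deriv p n) ⟨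
  c ℚ.* coeff (deriv p) n                       ≡⟨ coeff-· c (deriv p) n ⟨
  coeff (c ·ₚ deriv p) n                        ∎
  where open ≡-Reasoning

deriv-neg : ∀ p → deriv (-ₚ p) ≋ -ₚ deriv p
deriv-neg p = mk≋ λ n → begin
  coeff (deriv (-ₚ p)) n                        ≡⟨ coeff-deriv (-ₚ p) n ⟩
  ℕ→ℚ (suc n) ℚ.* coeff (-ₚ p) (suc n)          ≡⟨ cong (ℕ→ℚ (suc n) ℚ.*_) (coeff-neg p (suc n)) ⟩
  ℕ→ℚ (suc n) ℚ.* (ℚ.- coeff p (suc n))         ≡⟨ ℚP.neg-distribʳ-* (ℕ→ℚ (suc n)) (coeff p (suc n)) ⟨
  ℚ.- (ℕ→ℚ (suc n) ℚ.* coeff p (suc n))         ≡⟨ cong ℚ.-_ (coeff-deriv p n) ⟨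
  ℚ.- coeff (deriv p) n                         ≡⟨ coeff-neg (deriv p) n ⟨
  coeff (-ₚ deriv p) n                          ∎
  where open ≡-Reasoning

deriv-sub : ∀ p q → deriv (p -ₚ q) ≋ deriv p -ₚ deriv q
deriv-sub p q = ≋-trans (deriv-+ p (-ₚ q)) (+ₚ-congˡ (deriv p) (deriv-neg q))

deriv-∷ : ∀ a p → deriv (a ∷ p) ≋ p +ₚ X *ₚ deriv p
deriv-∷ a p = ≋-sym (≋-trans (+ₚ-congˡ p (X-*ₚ (deriv p))) (mk≋ coeffs))
  where
  coeffs : p +ₚ (0ℚ ∷ deriv p) ≈ₚ deriv (a ∷ p)
  coeffs zero = begin
    coeff (p +ₚ (0ℚ ∷ deriv p)) 0   ≡⟨ coeff-+ p (0ℚ ∷ deriv p) 0 ⟩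
    coeff p 0 ℚ.+ 0ℚ                ≡⟨ ℚP.+-identityʳ (coeff p 0) ⟩
    coeff p 0                       ≡⟨ ℚP.*-identityˡ (coeff p 0) ⟨
    1ℚ ℚ.* coeff p 0                ≡⟨ coeff-deriv (a ∷ p) 0 ⟨
    coeff (deriv (a ∷ p)) 0         ∎
    where open ≡-Reasoning
  coeffs (suc m) = begin
    coeff (p +ₚ (0ℚ ∷ deriv p)) (suc m)
      ≡⟨ coeff-+ p (0ℚ ∷ deriv p) (suc m) ⟩
    coeff p (suc m) ℚ.+ coeff (deriv p) m
      ≡⟨ cong (coeff p (suc m) ℚ.+_) (coeff-deriv p m) ⟩
    coeff p (suc m) ℚ.+ ℕ→ℚ (suc m) ℚ.* coeff p (suc m)
      ≡⟨ solve 2 (λ x a → x :+ a :* x := (con 1ℚ :+ a) :* x) refl (coeff p (suc m)) (ℕ→ℚ (suc m)) ⟩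
    (1ℚ ℚ.+ ℕ→ℚ (suc m)) ℚ.* coeff p (suc m)
      ≡⟨ cong (ℚ._* coeff p (suc m)) (ℕ→ℚ-suc (suc m)) ⟨
    ℕ→ℚ (suc (suc m)) ℚ.* coeff p (suc m)
      ≡⟨ coeff-deriv (a ∷ p) (suc m) ⟨
    coeff (deriv (a ∷ p)) (suc m)
      ∎
    where open ≡-Reasoning

deriv-* : ∀ p q → deriv (p *ₚ q) ≋ deriv p *ₚ q +ₚ p *ₚ deriv q
deriv-* []      q = ≋-refl
deriv-* (a ∷ p) q = begin
  deriv (a ·ₚ q +ₚ (0ℚ ∷ p *ₚ q))
    ≈⟨ deriv-+ (a ·ₚ q) (0ℚ ∷ p *ₚ q) ⟩
  deriv (a ·ₚ q) +ₚ deriv (0ℚ ∷ p *ₚ q)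
    ≈⟨ +ₚ-cong (≋-trans (deriv-· a q) (·ₚ≋constₚ-*ₚ a (deriv q)))
               (≋-trans (deriv-∷ 0ℚ (p *ₚ q)) (+ₚ-congˡ (p *ₚ q) (*ₚ-congˡ X (deriv-* p q)))) ⟩
  constₚ a *ₚ deriv q +ₚ (p *ₚ q +ₚ X *ₚ (deriv p *ₚ q +ₚ p *ₚ deriv q))
    ≈⟨ psolve 6 (λ A x p p′ q q′ → A ⊗ q′ ⊕ (p ⊗ q ⊕ x ⊗ (p′ ⊗ q ⊕ p ⊗ q′)) ⊜ (p ⊕ x ⊗ p′) ⊗ q ⊕ (A ⊕ x ⊗ p) ⊗ q′)
                ≋-refl (constₚ a) X p (deriv p) q (deriv q) ⟩
  (p +ₚ X *ₚ deriv p) *ₚ q +ₚ (constₚ a +ₚ X *ₚ p) *ₚ deriv q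
    ≈⟨ +ₚ-cong (*ₚ-congʳ q (deriv-∷ a p)) (*ₚ-congʳ (deriv q) (∷≋constₚ+X*ₚ a p)) ⟨
  deriv (a ∷ p) *ₚ q +ₚ (a ∷ p) *ₚ deriv q
    ∎
  where open ≋-Reasoning

W[_,_] : Poly → Poly → Poly
W[ N , D ] = deriv N *ₚ D -ₚ N *ₚ deriv D

W-cong : ∀ {N N′ D D′} → N ≋ N′ → D ≋ D′ → W[ N , D ] ≋ W[ N′ , D′ ]
W-cong N≋N′ D≋D′ = +ₚ-cong (*ₚ-cong (deriv-cong N≋N′) D≋D′) (-ₚ-cong (*ₚ-cong N≋N′ (deriv-cong D≋D′)))

module _ {p : Poly} (p′≋1 : deriv p ≋ constₚ 1ℚ) where

  deriv-^ₚ-suc : ∀ s → deriv (p ^ₚ suc s) ≋ natₚ (suc s) *ₚ p ^ₚ s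
  deriv-^ₚ-suc zero = begin
    deriv (p *ₚ constₚ 1ℚ)                          ≈⟨ deriv-* p (constₚ 1ℚ) ⟩
    deriv p *ₚ constₚ 1ℚ +ₚ p *ₚ []                 ≈⟨ +ₚ-cong (*ₚ-congʳ (constₚ 1ℚ) p′≋1) (*ₚ-zeroʳ p) ⟩
    constₚ 1ℚ *ₚ constₚ 1ℚ +ₚ []                     ≈⟨ psolve 0 (κ 1ℚ ⊗ κ 1ℚ ⊕ κ 0ℚ ⊜ κ 1ℚ ⊗ κ 1ℚ) ≋-refl ⟩
    natₚ 1 *ₚ constₚ 1ℚ                             ∎
    where open ≋-Reasoning
  deriv-^ₚ-suc (suc s) = begin
    deriv (p *ₚ p ^ₚ suc s)
      ≈⟨ deriv-* p (p ^ₚ suc s) ⟩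
    deriv p *ₚ p ^ₚ suc s +ₚ p *ₚ deriv (p ^ₚ suc s)
      ≈⟨ +ₚ-cong (*ₚ-congʳ (p ^ₚ suc s) p′≋1) (*ₚ-congˡ p (deriv-^ₚ-suc s)) ⟩
    constₚ 1ℚ *ₚ p ^ₚ suc s +ₚ p *ₚ (natₚ (suc s) *ₚ p ^ₚ s)
      ≈⟨ psolve 3 (λ n p q → κ 1ℚ ⊗ (p ⊗ q) ⊕ p ⊗ (n ⊗ q) ⊜ (κ 1ℚ ⊕ n) ⊗ (p ⊗ q)) ≋-refl (natₚ (suc s)) p (p ^ₚ s) ⟩
    (constₚ 1ℚ +ₚ natₚ (suc s)) *ₚ p ^ₚ suc s
      ≈⟨ *ₚ-congʳ (p ^ₚ suc s) (natₚ-suc (suc s)) ⟨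
    natₚ (suc (suc s)) *ₚ p ^ₚ suc s
      ∎
    where open ≋-Reasoning

  *ₚ-deriv-^ₚ : ∀ m → p *ₚ deriv (p ^ₚ m) ≋ natₚ m *ₚ p ^ₚ m
  *ₚ-deriv-^ₚ zero    = ≋-trans (*ₚ-zeroʳ p) (≋-sym (*ₚ-congʳ (constₚ 1ℚ) constₚ-0))
  *ₚ-deriv-^ₚ (suc s) = ≋-trans (*ₚ-congˡ p (deriv-^ₚ-suc s))
    (psolve 3 (λ p n q → p ⊗ (n ⊗ q) ⊜ n ⊗ (p ⊗ q)) ≋-refl p (natₚ (suc s)) (p ^ₚ s))

  deriv-^ₚ-suc-*ₚ : ∀ s G → deriv (p ^ₚ suc s *ₚ G) ≋ p ^ₚ s *ₚ (natₚ (suc s) *ₚ G +ₚ p *ₚ deriv G)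
  deriv-^ₚ-suc-*ₚ s G = begin
    deriv (p ^ₚ suc s *ₚ G)
      ≈⟨ deriv-* (p ^ₚ suc s) G ⟩
    deriv (p ^ₚ suc s) *ₚ G +ₚ p ^ₚ suc s *ₚ deriv G
      ≈⟨ +ₚ-congʳ (p ^ₚ suc s *ₚ deriv G) (*ₚ-congʳ G (deriv-^ₚ-suc s)) ⟩
    natₚ (suc s) *ₚ p ^ₚ s *ₚ G +ₚ p *ₚ p ^ₚ s *ₚ deriv G
      ≈⟨ psolve 5 (λ n q G G′ p → n ⊗ q ⊗ G ⊕ p ⊗ q ⊗ G′ ⊜ q ⊗ (n ⊗ G ⊕ p ⊗ G′)) ≋-refl (natₚ (suc s)) (p ^ₚ s) G (deriv G) p ⟩
    p ^ₚ s *ₚ (natₚ (suc s) *ₚ G +ₚ p *ₚ deriv G)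
      ∎
    where open ≋-Reasoning

  W-^ₚ-suc : ∀ s G D → W[ p ^ₚ suc s *ₚ G , D ] ≋ p ^ₚ s *ₚ (natₚ (suc s) *ₚ G *ₚ D +ₚ p *ₚ W[ G , D ])
  W-^ₚ-suc s G D = begin
    deriv (p ^ₚ suc s *ₚ G) *ₚ D -ₚ p ^ₚ suc s *ₚ G *ₚ deriv D
      ≈⟨ +ₚ-congʳ (-ₚ (p ^ₚ suc s *ₚ G *ₚ deriv D)) (*ₚ-congʳ D (deriv-^ₚ-suc-*ₚ s G)) ⟩
    p ^ₚ s *ₚ (natₚ (suc s) *ₚ G +ₚ p *ₚ deriv G) *ₚ D -ₚ p *ₚ p ^ₚ s *ₚ G *ₚ deriv D
      ≈⟨ psolve 7 (λ P q n G G′ D D′ → q ⊗ (n ⊗ G ⊕ P ⊗ G′) ⊗ D ⊖ P ⊗ q ⊗ G ⊗ D′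
                                     ⊜ q ⊗ (n ⊗ G ⊗ D ⊕ P ⊗ (G′ ⊗ D ⊖ G ⊗ D′)))
                  ≋-refl p (p ^ₚ s) (natₚ (suc s)) G (deriv G) D (deriv D) ⟩
    p ^ₚ s *ₚ (natₚ (suc s) *ₚ G *ₚ D +ₚ p *ₚ W[ G , D ])
      ∎
    where open ≋-Reasoning

eval-natₚ : ∀ n x → eval (natₚ n) x ≡ ℕ→ℚ n
eval-natₚ n = eval-constₚ (ℕ→ℚ n)

eval-*ₚ-root : ∀ {p x} → eval p x ≡ 0ℚ → ∀ Z → eval (p *ₚ Z) x ≡ 0ℚ
eval-*ₚ-root {p} {x} p[x]≡0 Z = trans (eval-* p Z x) (trans (cong (ℚ._* eval Z x) p[x]≡0) (ℚP.*-zeroˡ (eval Z x)))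

eval-+ₚ-root-*ₚ : ∀ {p x} → eval p x ≡ 0ℚ → ∀ A Z → eval (A +ₚ p *ₚ Z) x ≡ eval A x
eval-+ₚ-root-*ₚ {p} {x} p[x]≡0 A Z =
  trans (eval-+ A (p *ₚ Z) x) (trans (cong (eval A x ℚ.+_) (eval-*ₚ-root {p} {x} p[x]≡0 Z)) (ℚP.+-identityʳ (eval A x)))

eval-natₚ-*ₚ : ∀ n G x → eval (natₚ n *ₚ G) x ≡ ℕ→ℚ n ℚ.* eval G x
eval-natₚ-*ₚ n G x = trans (eval-* (natₚ n) G x) (cong (ℚ._* eval G x) (eval-natₚ n x))

eval-W-cofactor : ∀ {p x} → eval p x ≡ 0ℚ → ∀ m G D Z →
                eval (natₚ m *ₚ G *ₚ D +ₚ p *ₚ Z) x ≡ ℕ→ℚ m ℚ.* eval G x ℚ.* eval D x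
eval-W-cofactor {p} {x} p[x]≡0 m G D Z = trans (eval-+ₚ-root-*ₚ {p} {x} p[x]≡0 (natₚ m *ₚ G *ₚ D) Z)
  (trans (eval-* (natₚ m *ₚ G) D x) (cong (ℚ._* eval D x) (eval-natₚ-*ₚ m G x)))

coeff-X^ₚ-*ₚ : ∀ m p t → coeff (X ^ₚ m *ₚ p) (m + t) ≡ coeff p t
coeff-X^ₚ-*ₚ zero    p t = get (*ₚ-identityˡ p) t
coeff-X^ₚ-*ₚ (suc m) p t =
  trans (get (≋-trans (*ₚ-assoc X (X ^ₚ m) p) (X-*ₚ (X ^ₚ m *ₚ p))) (suc (m + t))) (coeff-X^ₚ-*ₚ m p t)

coeff-X^ₚ-*ₚ-< : ∀ m p j → j < m → coeff (X ^ₚ m *ₚ p) j ≡ 0ℚ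
coeff-X^ₚ-*ₚ-< (suc m) p zero    _ = get (≋-trans (*ₚ-assoc X (X ^ₚ m) p) (X-*ₚ (X ^ₚ m *ₚ p))) zero
coeff-X^ₚ-*ₚ-< (suc m) p (suc j) (s≤s j<m) =
  trans (get (≋-trans (*ₚ-assoc X (X ^ₚ m) p) (X-*ₚ (X ^ₚ m *ₚ p))) (suc j)) (coeff-X^ₚ-*ₚ-< m p j j<m)

coeff-X^ₚ-*ₚ-at : ∀ m p → coeff (X ^ₚ m *ₚ p) m ≡ eval p 0ℚ
coeff-X^ₚ-*ₚ-at m p = trans (cong (coeff (X ^ₚ m *ₚ p)) (sym (ℕP.+-identityʳ m)))
                            (trans (coeff-X^ₚ-*ₚ m p 0) (sym (eval-0 p)))

U : Poly
U = X -ₚ constₚ 1ℚ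

deriv-X : deriv X ≋ constₚ 1ℚ
deriv-X = ≋-refl

deriv-U : deriv U ≋ constₚ 1ℚ
deriv-U = ≋-refl

eval-U-1 : eval U 1ℚ ≡ 0ℚ
eval-U-1 = refl

U*ₚ≋ : ∀ p → U *ₚ p ≋ (0ℚ ∷ p) -ₚ p
U*ₚ≋ p = ≋-trans (psolve 2 (λ x p → (x ⊖ κ 1ℚ) ⊗ p ⊜ x ⊗ p ⊖ p) ≋-refl X p) (+ₚ-congʳ (-ₚ p) (X-*ₚ p))

-- synthetic division by x - 1
quotientU : Poly → Poly
quotientU []      = []
quotientU (a ∷ p) = eval p 1ℚ ∷ quotientU p

divisionU : ∀ p → p ≋ U *ₚ quotientU p +ₚ constₚ (eval p 1ℚ)
divisionU []      = ≋-sym (≋-trans (+ₚ-congˡ (U *ₚ []) constₚ-0) (≋-trans (+ₚ-identityʳ _) (*ₚ-zeroʳ U)))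
divisionU (a ∷ p) = begin
  a ∷ p
    ≈⟨ ∷≋constₚ+X*ₚ a p ⟩
  constₚ a +ₚ X *ₚ p
    ≈⟨ +ₚ-congˡ (constₚ a) (*ₚ-congˡ X (divisionU p)) ⟩
  constₚ a +ₚ X *ₚ (U *ₚ q +ₚ constₚ e)
    ≈⟨ psolve 4 (λ A x q E → A ⊕ x ⊗ ((x ⊖ κ 1ℚ) ⊗ q ⊕ E) ⊜ (x ⊖ κ 1ℚ) ⊗ (E ⊕ x ⊗ q) ⊕ (A ⊕ κ 1ℚ ⊗ E))
                ≋-refl (constₚ a) X q (constₚ e) ⟩
  U *ₚ (constₚ e +ₚ X *ₚ q) +ₚ (constₚ a +ₚ constₚ 1ℚ *ₚ constₚ e)
    ≈⟨ +ₚ-cong (*ₚ-congˡ U (≋-sym (∷≋constₚ+X*ₚ e q))) (+ₚ-congˡ (constₚ a) (≋-sym (constₚ-homo-* 1ℚ e))) ⟩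
  U *ₚ (e ∷ q) +ₚ constₚ (a ℚ.+ 1ℚ ℚ.* e)
    ∎
  where
  open ≋-Reasoning
  q : Poly
  q = quotientU p
  e : ℚ
  e = eval p 1ℚ

factor-theorem-U : ∀ p → eval p 1ℚ ≡ 0ℚ → p ≋ U *ₚ quotientU p
factor-theorem-U p p[1]≡0 = begin
  p                                            ≈⟨ divisionU p ⟩
  U *ₚ quotientU p +ₚ constₚ (eval p 1ℚ)       ≈⟨ +ₚ-congˡ (U *ₚ quotientU p) (≋-trans (≡⇒≋ (cong constₚ p[1]≡0)) constₚ-0) ⟩
  U *ₚ quotientU p +ₚ []                       ≈⟨ +ₚ-identityʳ _ ⟩
  U *ₚ quotientU p                             ∎
  where open ≋-Reasoning

divisible-by-U^ : ∀ y m → eval y 1ℚ ≡ 0ℚ →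
                  (∀ s H → s < m → y ≋ U ^ₚ suc s *ₚ H → eval H 1ℚ ≡ 0ℚ) →
                  Σ Poly λ H → y ≋ U ^ₚ suc m *ₚ H
divisible-by-U^ y zero    y[1]≡0 step = quotientU y ,
  ≋-trans (factor-theorem-U y y[1]≡0) (*ₚ-congʳ (quotientU y) (≋-sym (*ₚ-identityʳ U)))
divisible-by-U^ y (suc m) y[1]≡0 step with divisible-by-U^ y m y[1]≡0 (λ s H s<m → step s H (ℕP.m<n⇒m<1+n s<m))
... | H , y≋ = quotientU H , (begin
  y                                   ≈⟨ y≋ ⟩
  U ^ₚ suc m *ₚ H                     ≈⟨ *ₚ-congˡ (U ^ₚ suc m) (factor-theorem-U H (step m H ℕP.≤-refl y≋)) ⟩
  U ^ₚ suc m *ₚ (U *ₚ quotientU H)    ≈⟨ psolve 3 (λ V u q → V ⊗ (u ⊗ q) ⊜ (u ⊗ V) ⊗ q) ≋-refl (U ^ₚ suc m) U (quotientU H) ⟩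
  U ^ₚ suc (suc m) *ₚ quotientU H     ∎)
  where open ≋-Reasoning

U*ₚ≋[]⇒≋[] : ∀ p → U *ₚ p ≋ [] → p ≋ []
U*ₚ≋[]⇒≋[] p Up≋0 = mk≋ p≈0
  where
  shifted≈p : (0ℚ ∷ p) -ₚ p ≈ₚ []
  shifted≈p = get (≋-trans (≋-sym (U*ₚ≋ p)) Up≋0)
  p≈0 : ∀ n → coeff p n ≡ 0ℚ
  p≈0 zero    = ℚP.neg-injective (trans (sym (ℚP.+-identityˡ _)) (trans (sym (coeff-sub (0ℚ ∷ p) p 0)) (shifted≈p 0)))
  p≈0 (suc n) = trans (sym (x-y≡0⇒x≡y (trans (sym (coeff-sub (0ℚ ∷ p) p (suc n))) (shifted≈p (suc n))))) (p≈0 n)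

U-*ₚ-cancelˡ : ∀ {p q} → U *ₚ p ≋ U *ₚ q → p ≋ q
U-*ₚ-cancelˡ {p} {q} Up≋Uq = p-q≋0⇒p≋q p q (U*ₚ≋[]⇒≋[] (p -ₚ q) (begin
  U *ₚ (p -ₚ q)                 ≈⟨ psolve 3 (λ u p q → u ⊗ (p ⊖ q) ⊜ u ⊗ p ⊖ u ⊗ q) ≋-refl U p q ⟩
  U *ₚ p -ₚ U *ₚ q              ≈⟨ +ₚ-congʳ (-ₚ (U *ₚ q)) Up≋Uq ⟩
  U *ₚ q -ₚ U *ₚ q              ≈⟨ -ₚ-inverseʳ (U *ₚ q) ⟩
  []                            ∎))
  where open ≋-Reasoning

U^ₚ-*ₚ-cancelˡ : ∀ n {p q} → U ^ₚ n *ₚ p ≋ U ^ₚ n *ₚ q → p ≋ q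
U^ₚ-*ₚ-cancelˡ zero    {p} {q} eq = ≋-trans (≋-sym (*ₚ-identityˡ p)) (≋-trans eq (*ₚ-identityˡ q))
U^ₚ-*ₚ-cancelˡ (suc n) {p} {q} eq = U^ₚ-*ₚ-cancelˡ n (U-*ₚ-cancelˡ
  (≋-trans (≋-sym (*ₚ-assoc U (U ^ₚ n) p)) (≋-trans eq (*ₚ-assoc U (U ^ₚ n) q))))

DegreeBelow : ℕ → Poly → Set
DegreeBelow b p = ∀ j → b ≤ j → coeff p j ≡ 0ℚ

DegreeBelow-cong : ∀ {b p q} → p ≋ q → DegreeBelow b p → DegreeBelow b q
DegreeBelow-cong p≋q deg j b≤j = trans (sym (get p≋q j)) (deg j b≤j)

coeff-≥length : ∀ p j → length p ≤ j → coeff p j ≡ 0ℚ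
coeff-≥length []      j       _         = refl
coeff-≥length (a ∷ p) (suc j) (s≤s l≤j) = coeff-≥length p j l≤j

-- The coefficients of p from index b on are constant (since (x-1)p has none
-- there), and they are eventually zero.
DegreeBelow-U*ₚ : ∀ b p → DegreeBelow (suc b) (U *ₚ p) → DegreeBelow b p
DegreeBelow-U*ₚ b p deg j b≤j = trans (constant (length p)) (coeff-≥length p (j + length p) (ℕP.m≤n+m (length p) j))
  where
  step : ∀ i → b ≤ i → coeff p i ≡ coeff p (suc i)
  step i b≤i = x-y≡0⇒x≡y (trans (sym (coeff-sub (0ℚ ∷ p) p (suc i))) (trans (sym (get (U*ₚ≋ p) (suc i))) (deg (suc i) (s≤s b≤i))))
  constant : ∀ t → coeff p j ≡ coeff p (j + t)
  constant zero    = cong (coeff p) (sym (ℕP.+-identityʳ j))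
  constant (suc t) = trans (constant t) (trans (step (j + t) (ℕP.≤-trans b≤j (ℕP.m≤m+n j t))) (cong (coeff p) (sym (ℕP.+-suc j t))))

DegreeBelow-U^ₚ-*ₚ : ∀ m b p → DegreeBelow (m + b) (U ^ₚ m *ₚ p) → DegreeBelow b p
DegreeBelow-U^ₚ-*ₚ zero    b p deg = DegreeBelow-cong (*ₚ-identityˡ p) deg
DegreeBelow-U^ₚ-*ₚ (suc m) b p deg =
  DegreeBelow-U^ₚ-*ₚ m b p (DegreeBelow-U*ₚ (m + b) (U ^ₚ m *ₚ p) (DegreeBelow-cong (*ₚ-assoc U (U ^ₚ m) p) deg))

-- The hypergeometric equation

ϑ : Poly → Poly
ϑ y = X *ₚ deriv y

coeff-ϑ : ∀ y n → coeff (ϑ y) n ≡ ℕ→ℚ n ℚ.* coeff y n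
coeff-ϑ y zero    = trans (get (X-*ₚ (deriv y)) 0) (sym (ℚP.*-zeroˡ (coeff y 0)))
coeff-ϑ y (suc n) = trans (get (X-*ₚ (deriv y)) (suc n)) (coeff-deriv y n)

module Hypergeometric (α β c : ℚ) where

  σ : ℚ
  σ = α ℚ.+ β ℚ.+ 1ℚ

  Q R : Poly
  Q = X -ₚ X *ₚ X
  R = constₚ c -ₚ constₚ σ *ₚ X

  L : Poly → Poly
  L y = Q *ₚ deriv (deriv y) +ₚ R *ₚ deriv y -ₚ constₚ (α ℚ.* β) *ₚ y

  L-cong : ∀ {y z} → y ≋ z → L y ≋ L z
  L-cong y≋z = +ₚ-cong (+ₚ-cong (*ₚ-congˡ Q (deriv-cong (deriv-cong y≋z))) (*ₚ-congˡ R (deriv-cong y≋z)))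
                       (-ₚ-cong (*ₚ-congˡ (constₚ (α ℚ.* β)) y≋z))

  -- L⁺ lowers degrees by one and L⁻ preserves them, whence a two-term recurrence.
  L⁺ L⁻ : Poly → Poly
  L⁺ y = deriv (ϑ y) +ₚ (c ℚ.- 1ℚ) ·ₚ deriv y
  L⁻ y = ϑ (ϑ y) +ₚ (σ ℚ.- 1ℚ) ·ₚ ϑ y +ₚ (α ℚ.* β) ·ₚ y

  L≋L⁺-L⁻ : ∀ y → L y ≋ L⁺ y -ₚ L⁻ y
  L≋L⁺-L⁻ y = ≋-sym (begin
    deriv (X *ₚ y′) +ₚ (c ℚ.- 1ℚ) ·ₚ y′ -ₚ (X *ₚ deriv (X *ₚ y′) +ₚ (σ ℚ.- 1ℚ) ·ₚ (X *ₚ y′) +ₚ (α ℚ.* β) ·ₚ y)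
      ≈⟨ +ₚ-cong (+ₚ-cong (deriv-* X y′) (·ₚ≋constₚ-*ₚ (c ℚ.- 1ℚ) y′))
                 (-ₚ-cong (+ₚ-cong (+ₚ-cong (*ₚ-congˡ X (deriv-* X y′)) (·ₚ≋constₚ-*ₚ (σ ℚ.- 1ℚ) (X *ₚ y′)))
                                   (·ₚ≋constₚ-*ₚ (α ℚ.* β) y))) ⟩
    constₚ 1ℚ *ₚ y′ +ₚ X *ₚ y″ +ₚ constₚ (c ℚ.- 1ℚ) *ₚ y′
      -ₚ (X *ₚ (constₚ 1ℚ *ₚ y′ +ₚ X *ₚ y″) +ₚ constₚ (σ ℚ.- 1ℚ) *ₚ (X *ₚ y′) +ₚ constₚ (α ℚ.* β) *ₚ y)
      ≈⟨ psolve 7 (λ x y y′ y″ C S P → κ 1ℚ ⊗ y′ ⊕ x ⊗ y″ ⊕ (C ⊖ κ 1ℚ) ⊗ y′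
                                        ⊖ (x ⊗ (κ 1ℚ ⊗ y′ ⊕ x ⊗ y″) ⊕ (S ⊖ κ 1ℚ) ⊗ (x ⊗ y′) ⊕ P ⊗ y)
                                      ⊜ (x ⊖ x ⊗ x) ⊗ y″ ⊕ (C ⊖ S ⊗ x) ⊗ y′ ⊖ P ⊗ y)
                  ≋-refl X y y′ y″ (constₚ c) (constₚ σ) (constₚ (α ℚ.* β)) ⟩
    L y
      ∎)
    where
    open ≋-Reasoning
    y′ y″ : Poly
    y′ = deriv y
    y″ = deriv (deriv y)

  coeff-L⁺ : ∀ y n → coeff (L⁺ y) n ≡ ℕ→ℚ (suc n) ℚ.* (ℕ→ℚ n ℚ.+ c) ℚ.* coeff y (suc n)
  coeff-L⁺ y n = begin
    coeff (deriv (ϑ y) +ₚ (c ℚ.- 1ℚ) ·ₚ deriv y) n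
      ≡⟨ coeff-+ (deriv (ϑ y)) ((c ℚ.- 1ℚ) ·ₚ deriv y) n ⟩
    coeff (deriv (ϑ y)) n ℚ.+ coeff ((c ℚ.- 1ℚ) ·ₚ deriv y) n
      ≡⟨ cong₂ ℚ._+_ (trans (coeff-deriv (ϑ y) n) (cong (ℕ→ℚ (suc n) ℚ.*_) (coeff-ϑ y (suc n))))
                     (trans (coeff-· (c ℚ.- 1ℚ) (deriv y) n) (cong ((c ℚ.- 1ℚ) ℚ.*_) (coeff-deriv y n))) ⟩
    n₁ ℚ.* (n₁ ℚ.* y₁) ℚ.+ (c ℚ.- 1ℚ) ℚ.* (n₁ ℚ.* y₁)
      ≡⟨ cong (λ m → m ℚ.* (m ℚ.* y₁) ℚ.+ (c ℚ.- 1ℚ) ℚ.* (m ℚ.* y₁)) (ℕ→ℚ-suc n) ⟩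
    (1ℚ ℚ.+ n₀) ℚ.* ((1ℚ ℚ.+ n₀) ℚ.* y₁) ℚ.+ (c ℚ.- 1ℚ) ℚ.* ((1ℚ ℚ.+ n₀) ℚ.* y₁)
      ≡⟨ solve 3 (λ n c y → (con 1ℚ :+ n) :* ((con 1ℚ :+ n) :* y) :+ (c :- con 1ℚ) :* ((con 1ℚ :+ n) :* y)
                            := (con 1ℚ :+ n) :* (n :+ c) :* y) refl n₀ c y₁ ⟩
    (1ℚ ℚ.+ n₀) ℚ.* (n₀ ℚ.+ c) ℚ.* y₁
      ≡⟨ cong (λ m → m ℚ.* (n₀ ℚ.+ c) ℚ.* y₁) (ℕ→ℚ-suc n) ⟨
    n₁ ℚ.* (n₀ ℚ.+ c) ℚ.* y₁
      ∎
    where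
    open ≡-Reasoning
    n₀ n₁ y₁ : ℚ
    n₀ = ℕ→ℚ n
    n₁ = ℕ→ℚ (suc n)
    y₁ = coeff y (suc n)

  coeff-L⁻ : ∀ y n → coeff (L⁻ y) n ≡ (ℕ→ℚ n ℚ.+ α) ℚ.* (ℕ→ℚ n ℚ.+ β) ℚ.* coeff y n
  coeff-L⁻ y n = begin
    coeff (ϑ (ϑ y) +ₚ (σ ℚ.- 1ℚ) ·ₚ ϑ y +ₚ (α ℚ.* β) ·ₚ y) n
      ≡⟨ coeff-+ (ϑ (ϑ y) +ₚ (σ ℚ.- 1ℚ) ·ₚ ϑ y) ((α ℚ.* β) ·ₚ y) n ⟩
    coeff (ϑ (ϑ y) +ₚ (σ ℚ.- 1ℚ) ·ₚ ϑ y) n ℚ.+ coeff ((α ℚ.* β) ·ₚ y) n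
      ≡⟨ cong₂ ℚ._+_ (coeff-+ (ϑ (ϑ y)) ((σ ℚ.- 1ℚ) ·ₚ ϑ y) n) (coeff-· (α ℚ.* β) y n) ⟩
    coeff (ϑ (ϑ y)) n ℚ.+ coeff ((σ ℚ.- 1ℚ) ·ₚ ϑ y) n ℚ.+ α ℚ.* β ℚ.* y₀
      ≡⟨ cong₂ (λ u v → u ℚ.+ v ℚ.+ α ℚ.* β ℚ.* y₀)
               (trans (coeff-ϑ (ϑ y) n) (cong (n₀ ℚ.*_) (coeff-ϑ y n)))
               (trans (coeff-· (σ ℚ.- 1ℚ) (ϑ y) n) (cong ((σ ℚ.- 1ℚ) ℚ.*_) (coeff-ϑ y n))) ⟩
    n₀ ℚ.* (n₀ ℚ.* y₀) ℚ.+ (σ ℚ.- 1ℚ) ℚ.* (n₀ ℚ.* y₀) ℚ.+ α ℚ.* β ℚ.* y₀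
      ≡⟨ solve 4 (λ n a b y → n :* (n :* y) :+ (a :+ b :+ con 1ℚ :- con 1ℚ) :* (n :* y) :+ a :* b :* y
                              := (n :+ a) :* (n :+ b) :* y) refl n₀ α β y₀ ⟩
    (n₀ ℚ.+ α) ℚ.* (n₀ ℚ.+ β) ℚ.* y₀
      ∎
    where
    open ≡-Reasoning
    n₀ y₀ : ℚ
    n₀ = ℕ→ℚ n
    y₀ = coeff y n

  coeff-L : ∀ y n → coeff (L y) n ≡ ℕ→ℚ (suc n) ℚ.* (ℕ→ℚ n ℚ.+ c) ℚ.* coeff y (suc n)
                                    ℚ.- (ℕ→ℚ n ℚ.+ α) ℚ.* (ℕ→ℚ n ℚ.+ β) ℚ.* coeff y n
  coeff-L y n = trans (get (L≋L⁺-L⁻ y) n) (trans (coeff-sub (L⁺ y) (L⁻ y) n) (cong₂ ℚ._-_ (coeff-L⁺ y n) (coeff-L⁻ y n)))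

  Recurrence : Poly → Set
  Recurrence y = ∀ n → ℕ→ℚ (suc n) ℚ.* (ℕ→ℚ n ℚ.+ c) ℚ.* coeff y (suc n)
                       ≡ (ℕ→ℚ n ℚ.+ α) ℚ.* (ℕ→ℚ n ℚ.+ β) ℚ.* coeff y n

  Recurrence⇒L≋0 : ∀ y → Recurrence y → L y ≋ []
  Recurrence⇒L≋0 y rec = mk≋ λ n → trans (coeff-L y n) (x≡y⇒x-y≡0 (rec n))

  WEquation : Poly → Set
  WEquation W = Q *ₚ deriv W +ₚ R *ₚ W ≋ []

  L≋0⇒W-equation : ∀ N D → L N ≋ [] → L D ≋ [] → WEquation W[ N , D ]
  L≋0⇒W-equation N D LN≋0 LD≋0 = begin
    Q *ₚ deriv W[ N , D ] +ₚ R *ₚ W[ N , D ]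
      ≈⟨ +ₚ-congʳ (R *ₚ W[ N , D ]) (*ₚ-congˡ Q (≋-trans (deriv-sub (N′ *ₚ D) (N *ₚ D′))
                                                      (+ₚ-cong (deriv-* N′ D) (-ₚ-cong (deriv-* N D′))))) ⟩
    Q *ₚ ((N″ *ₚ D +ₚ N′ *ₚ D′) -ₚ (N′ *ₚ D′ +ₚ N *ₚ D″)) +ₚ R *ₚ (N′ *ₚ D -ₚ N *ₚ D′)
      ≈⟨ psolve 9 (λ q r s n d n′ d′ n″ d″ → q ⊗ ((n″ ⊗ d ⊕ n′ ⊗ d′) ⊖ (n′ ⊗ d′ ⊕ n ⊗ d″)) ⊕ r ⊗ (n′ ⊗ d ⊖ n ⊗ d′)
                                           ⊜ d ⊗ (q ⊗ n″ ⊕ r ⊗ n′ ⊖ s ⊗ n) ⊖ n ⊗ (q ⊗ d″ ⊕ r ⊗ d′ ⊖ s ⊗ d))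
                  ≋-refl Q R (constₚ (α ℚ.* β)) N D N′ D′ N″ D″ ⟩
    D *ₚ L N -ₚ N *ₚ L D
      ≈⟨ +ₚ-cong (*ₚ-congˡ D LN≋0) (-ₚ-cong (*ₚ-congˡ N LD≋0)) ⟩
    D *ₚ [] -ₚ N *ₚ []
      ≈⟨ +ₚ-cong (*ₚ-zeroʳ D) (-ₚ-cong (*ₚ-zeroʳ N)) ⟩
    []
      ∎
    where
    open ≋-Reasoning
    N′ N″ D′ D″ : Poly
    N′ = deriv N
    N″ = deriv (deriv N)
    D′ = deriv D
    D″ = deriv (deriv D)

  WEquation-linear : ∀ {V W} e → WEquation V → WEquation W → WEquation (V -ₚ e ·ₚ W)
  WEquation-linear {V} {W} e V-eqn W-eqn = begin
    Q *ₚ deriv (V -ₚ e ·ₚ W) +ₚ R *ₚ (V -ₚ e ·ₚ W)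
      ≈⟨ +ₚ-cong (*ₚ-congˡ Q (≋-trans (deriv-sub V (e ·ₚ W)) (+ₚ-congˡ (deriv V) (-ₚ-cong (≋-trans (deriv-· e W) (·ₚ≋constₚ-*ₚ e (deriv W)))))))
                 (*ₚ-congˡ R (+ₚ-congˡ V (-ₚ-cong (·ₚ≋constₚ-*ₚ e W)))) ⟩
    Q *ₚ (deriv V -ₚ constₚ e *ₚ deriv W) +ₚ R *ₚ (V -ₚ constₚ e *ₚ W)
      ≈⟨ psolve 7 (λ q r v v′ w w′ e → q ⊗ (v′ ⊖ e ⊗ w′) ⊕ r ⊗ (v ⊖ e ⊗ w) ⊜ (q ⊗ v′ ⊕ r ⊗ v) ⊖ e ⊗ (q ⊗ w′ ⊕ r ⊗ w))
                  ≋-refl Q R V (deriv V) W (deriv W) (constₚ e) ⟩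
    (Q *ₚ deriv V +ₚ R *ₚ V) -ₚ constₚ e *ₚ (Q *ₚ deriv W +ₚ R *ₚ W)
      ≈⟨ +ₚ-cong V-eqn (-ₚ-cong (≋-trans (*ₚ-congˡ (constₚ e) W-eqn) (*ₚ-zeroʳ (constₚ e)))) ⟩
    []
      ∎
    where open ≋-Reasoning

  W-equation≋ : ∀ W → Q *ₚ deriv W +ₚ R *ₚ W ≋ (ϑ W +ₚ c ·ₚ W) -ₚ X *ₚ (ϑ W +ₚ σ ·ₚ W)
  W-equation≋ W = begin
    Q *ₚ deriv W +ₚ R *ₚ W
      ≈⟨ psolve 5 (λ x W W′ C S → (x ⊖ x ⊗ x) ⊗ W′ ⊕ (C ⊖ S ⊗ x) ⊗ W ⊜ (x ⊗ W′ ⊕ C ⊗ W) ⊖ x ⊗ (x ⊗ W′ ⊕ S ⊗ W))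
                  ≋-refl X W (deriv W) (constₚ c) (constₚ σ) ⟩
    (ϑ W +ₚ constₚ c *ₚ W) -ₚ X *ₚ (ϑ W +ₚ constₚ σ *ₚ W)
      ≈⟨ +ₚ-cong (+ₚ-congˡ (ϑ W) (≋-sym (·ₚ≋constₚ-*ₚ c W)))
                 (-ₚ-cong (*ₚ-congˡ X (+ₚ-congˡ (ϑ W) (≋-sym (·ₚ≋constₚ-*ₚ σ W))))) ⟩
    (ϑ W +ₚ c ·ₚ W) -ₚ X *ₚ (ϑ W +ₚ σ ·ₚ W)
      ∎
    where open ≋-Reasoning

  WEquation-coeff : ∀ W → WEquation W → ∀ n → (ℕ→ℚ n ℚ.+ c) ℚ.* coeff W n ≡ coeff (0ℚ ∷ ϑ W +ₚ σ ·ₚ W) n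
  WEquation-coeff W eqn n = begin
    (ℕ→ℚ n ℚ.+ c) ℚ.* coeff W n                  ≡⟨ ℚP.*-distribʳ-+ (coeff W n) (ℕ→ℚ n) c ⟩
    ℕ→ℚ n ℚ.* coeff W n ℚ.+ c ℚ.* coeff W n      ≡⟨ x-y≡0⇒x≡y (trans (sym coeff-E) (get E≋0 n)) ⟩
    coeff (0ℚ ∷ ϑ W +ₚ σ ·ₚ W) n                 ∎
    where
    open ≡-Reasoning
    E : Poly
    E = (ϑ W +ₚ c ·ₚ W) -ₚ X *ₚ (ϑ W +ₚ σ ·ₚ W)
    E≋0 : E ≋ []
    E≋0 = ≋-trans (≋-sym (W-equation≋ W)) eqn
    coeff-E : coeff E n ≡ (ℕ→ℚ n ℚ.* coeff W n ℚ.+ c ℚ.* coeff W n) ℚ.- coeff (0ℚ ∷ ϑ W +ₚ σ ·ₚ W) n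
    coeff-E = trans (coeff-sub (ϑ W +ₚ c ·ₚ W) (X *ₚ (ϑ W +ₚ σ ·ₚ W)) n)
                    (cong₂ ℚ._-_ (trans (coeff-+ (ϑ W) (c ·ₚ W) n) (cong₂ ℚ._+_ (coeff-ϑ W n) (coeff-· c W n)))
                                 (get (X-*ₚ (ϑ W +ₚ σ ·ₚ W)) n))

  -- By WEquation-coeff, W_n is determined by W_(n-1) except where n + c = 0.
  W-equation-unique : ∀ a W → WEquation W → ℕ→ℚ a ℚ.+ c ≡ 0ℚ → coeff W a ≡ 0ℚ → W ≋ []
  W-equation-unique a W eqn a+c≡0 W[a]≡0 = mk≋ W≈0
    where
    n+c≢0 : ∀ n → n ≢ a → ℕ→ℚ n ℚ.+ c ≢ 0ℚ
    n+c≢0 n n≢a n+c≡0 = n≢a (ℕ→ℚ-injective (x-y≡0⇒x≡y (begin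
      ℕ→ℚ n ℚ.- ℕ→ℚ a                         ≡⟨ solve 3 (λ n a c → n :- a := (n :+ c) :- (a :+ c)) refl (ℕ→ℚ n) (ℕ→ℚ a) c ⟩
      (ℕ→ℚ n ℚ.+ c) ℚ.- (ℕ→ℚ a ℚ.+ c)         ≡⟨ cong₂ ℚ._-_ n+c≡0 a+c≡0 ⟩
      0ℚ ℚ.- 0ℚ                               ≡⟨ ℚP.+-inverseʳ 0ℚ ⟩
      0ℚ                                      ∎)))
      where open ≡-Reasoning
    W≈0 : ∀ n → coeff W n ≡ 0ℚ
    previous≡0 : ∀ n → coeff (0ℚ ∷ ϑ W +ₚ σ ·ₚ W) n ≡ 0ℚ
    W≈0 n with n ℕ.≟ a
    ... | yes refl = W[a]≡0
    ... | no n≢a   = x*y≡0⇒y≡0 (n+c≢0 n n≢a) (trans (WEquation-coeff W eqn n) (previous≡0 n))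
    previous≡0 zero    = refl
    previous≡0 (suc m) = begin
      coeff (ϑ W +ₚ σ ·ₚ W) m                    ≡⟨ coeff-+ (ϑ W) (σ ·ₚ W) m ⟩
      coeff (ϑ W) m ℚ.+ coeff (σ ·ₚ W) m         ≡⟨ cong₂ ℚ._+_ (coeff-ϑ W m) (coeff-· σ W m) ⟩
      ℕ→ℚ m ℚ.* coeff W m ℚ.+ σ ℚ.* coeff W m    ≡⟨ cong (λ v → ℕ→ℚ m ℚ.* v ℚ.+ σ ℚ.* v) (W≈0 m) ⟩
      ℕ→ℚ m ℚ.* 0ℚ ℚ.+ σ ℚ.* 0ℚ                  ≡⟨ solve 2 (λ m s → m :* con 0ℚ :+ s :* con 0ℚ := con 0ℚ) refl (ℕ→ℚ m) σ ⟩
      0ℚ                                         ∎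
      where open ≡-Reasoning

  eval-R-1 : eval R 1ℚ ≡ c ℚ.- σ
  eval-R-1 = begin
    eval (constₚ c -ₚ constₚ σ *ₚ X) 1ℚ               ≡⟨ eval-sub (constₚ c) (constₚ σ *ₚ X) 1ℚ ⟩
    eval (constₚ c) 1ℚ ℚ.- eval (constₚ σ *ₚ X) 1ℚ    ≡⟨ cong₂ ℚ._-_ (eval-constₚ c 1ℚ) (eval-* (constₚ σ) X 1ℚ) ⟩
    c ℚ.- eval (constₚ σ) 1ℚ ℚ.* eval X 1ℚ            ≡⟨ cong₂ (λ u v → c ℚ.- u ℚ.* v) (eval-constₚ σ 1ℚ) (eval-X 1ℚ) ⟩
    c ℚ.- σ ℚ.* 1ℚ                                    ≡⟨ cong (λ z → c ℚ.- z) (ℚP.*-identityʳ σ) ⟩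
    c ℚ.- σ                                           ∎
    where open ≡-Reasoning

  L-U^ₚ-suc-*ₚ : ∀ s H → Σ Poly λ V → (L (U ^ₚ suc s *ₚ H) ≋ U ^ₚ s *ₚ V)
                                     × (eval V 1ℚ ≡ (c ℚ.- σ ℚ.- ℕ→ℚ s) ℚ.* (ℕ→ℚ (suc s) ℚ.* eval H 1ℚ))
  L-U^ₚ-suc-*ₚ s H = V , L≋ , eval-V
    where
    P G Z V : Poly
    P = constₚ (α ℚ.* β)
    G = natₚ (suc s) *ₚ H +ₚ U *ₚ deriv H
    Z = natₚ s *ₚ G +ₚ U *ₚ deriv G
    V = (-ₚ X *ₚ Z +ₚ R *ₚ G) +ₚ U *ₚ (-ₚ P *ₚ H)
    y′≋ : deriv (U ^ₚ suc s *ₚ H) ≋ U ^ₚ s *ₚ G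
    y′≋ = deriv-^ₚ-suc-*ₚ deriv-U s H
    L≋ : L (U ^ₚ suc s *ₚ H) ≋ U ^ₚ s *ₚ V
    L≋ = begin
      L (U ^ₚ suc s *ₚ H)
        ≈⟨ +ₚ-cong (+ₚ-cong (*ₚ-congˡ Q (≋-trans (deriv-cong y′≋) (deriv-* (U ^ₚ s) G))) (*ₚ-congˡ R y′≋))
                   (-ₚ-cong (*ₚ-congˡ P (*ₚ-assoc U (U ^ₚ s) H))) ⟩
      Q *ₚ (deriv (U ^ₚ s) *ₚ G +ₚ U ^ₚ s *ₚ deriv G) +ₚ R *ₚ (U ^ₚ s *ₚ G) -ₚ P *ₚ (U *ₚ (U ^ₚ s *ₚ H))
        ≈⟨ psolve 8 (λ x Us dUs G G′ r P H → let u = x ⊖ κ 1ℚ in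
                      (x ⊖ x ⊗ x) ⊗ (dUs ⊗ G ⊕ Us ⊗ G′) ⊕ r ⊗ (Us ⊗ G) ⊖ P ⊗ (u ⊗ (Us ⊗ H))
                      ⊜ (⊝ x) ⊗ (u ⊗ dUs) ⊗ G ⊕ Us ⊗ ((⊝ x) ⊗ (u ⊗ G′) ⊕ r ⊗ G ⊕ u ⊗ ((⊝ P) ⊗ H)))
                    ≋-refl X (U ^ₚ s) (deriv (U ^ₚ s)) G (deriv G) R P H ⟩
      -ₚ X *ₚ (U *ₚ deriv (U ^ₚ s)) *ₚ G +ₚ U ^ₚ s *ₚ (-ₚ X *ₚ (U *ₚ deriv G) +ₚ R *ₚ G +ₚ U *ₚ (-ₚ P *ₚ H))
        ≈⟨ +ₚ-congʳ (U ^ₚ s *ₚ (-ₚ X *ₚ (U *ₚ deriv G) +ₚ R *ₚ G +ₚ U *ₚ (-ₚ P *ₚ H)))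
                    (*ₚ-congʳ G (*ₚ-congˡ (-ₚ X) (*ₚ-deriv-^ₚ deriv-U s))) ⟩
      -ₚ X *ₚ (natₚ s *ₚ U ^ₚ s) *ₚ G +ₚ U ^ₚ s *ₚ (-ₚ X *ₚ (U *ₚ deriv G) +ₚ R *ₚ G +ₚ U *ₚ (-ₚ P *ₚ H))
        ≈⟨ psolve 8 (λ x u Us n G G′ r Y → (⊝ x) ⊗ (n ⊗ Us) ⊗ G ⊕ Us ⊗ ((⊝ x) ⊗ (u ⊗ G′) ⊕ r ⊗ G ⊕ Y)
                                           ⊜ Us ⊗ ((⊝ x) ⊗ (n ⊗ G ⊕ u ⊗ G′) ⊕ r ⊗ G ⊕ Y))
                    ≋-refl X U (U ^ₚ s) (natₚ s) G (deriv G) R (U *ₚ (-ₚ P *ₚ H)) ⟩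
      U ^ₚ s *ₚ V
        ∎
      where open ≋-Reasoning
    eval-G : eval G 1ℚ ≡ ℕ→ℚ (suc s) ℚ.* eval H 1ℚ
    eval-G = trans (eval-+ₚ-root-*ₚ {U} {1ℚ} eval-U-1 (natₚ (suc s) *ₚ H) (deriv H)) (eval-natₚ-*ₚ (suc s) H 1ℚ)
    eval-Z : eval Z 1ℚ ≡ ℕ→ℚ s ℚ.* eval G 1ℚ
    eval-Z = trans (eval-+ₚ-root-*ₚ {U} {1ℚ} eval-U-1 (natₚ s *ₚ G) (deriv G)) (eval-natₚ-*ₚ s G 1ℚ)
    eval-X*Z : eval (-ₚ X *ₚ Z) 1ℚ ≡ ℚ.- (ℕ→ℚ s ℚ.* eval G 1ℚ)
    eval-X*Z = begin
      eval (-ₚ X *ₚ Z) 1ℚ                  ≡⟨ eval-* (-ₚ X) Z 1ℚ ⟩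
      eval (-ₚ X) 1ℚ ℚ.* eval Z 1ℚ         ≡⟨ cong₂ ℚ._*_ (trans (eval-neg X 1ℚ) (cong ℚ.-_ (eval-X 1ℚ))) eval-Z ⟩
      ℚ.- 1ℚ ℚ.* (ℕ→ℚ s ℚ.* eval G 1ℚ)     ≡⟨ ℚP.neg-distribˡ-* 1ℚ (ℕ→ℚ s ℚ.* eval G 1ℚ) ⟨
      ℚ.- (1ℚ ℚ.* (ℕ→ℚ s ℚ.* eval G 1ℚ))   ≡⟨ cong ℚ.-_ (ℚP.*-identityˡ (ℕ→ℚ s ℚ.* eval G 1ℚ)) ⟩
      ℚ.- (ℕ→ℚ s ℚ.* eval G 1ℚ)            ∎
      where open ≡-Reasoning
    eval-V : eval V 1ℚ ≡ (c ℚ.- σ ℚ.- ℕ→ℚ s) ℚ.* (ℕ→ℚ (suc s) ℚ.* eval H 1ℚ)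
    eval-V = begin
      eval V 1ℚ
        ≡⟨ eval-+ₚ-root-*ₚ {U} {1ℚ} eval-U-1 (-ₚ X *ₚ Z +ₚ R *ₚ G) (-ₚ P *ₚ H) ⟩
      eval (-ₚ X *ₚ Z +ₚ R *ₚ G) 1ℚ
        ≡⟨ eval-+ (-ₚ X *ₚ Z) (R *ₚ G) 1ℚ ⟩
      eval (-ₚ X *ₚ Z) 1ℚ ℚ.+ eval (R *ₚ G) 1ℚ
        ≡⟨ cong₂ ℚ._+_ eval-X*Z (eval-* R G 1ℚ) ⟩
      ℚ.- (ℕ→ℚ s ℚ.* eval G 1ℚ) ℚ.+ eval R 1ℚ ℚ.* eval G 1ℚ
        ≡⟨ cong₂ (λ u v → ℚ.- (ℕ→ℚ s ℚ.* v) ℚ.+ u ℚ.* v) eval-R-1 eval-G ⟩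
      ℚ.- (ℕ→ℚ s ℚ.* g) ℚ.+ (c ℚ.- σ) ℚ.* g
        ≡⟨ solve 4 (λ n c s g → :- (n :* g) :+ (c :- s) :* g := (c :- s :- n) :* g) refl (ℕ→ℚ s) c σ g ⟩
      (c ℚ.- σ ℚ.- ℕ→ℚ s) ℚ.* g
        ∎
      where
      open ≡-Reasoning
      g : ℚ
      g = ℕ→ℚ (suc s) ℚ.* eval H 1ℚ

  L≋0⇒cofactor[1]≡0 : ∀ y s H → L y ≋ [] → y ≋ U ^ₚ suc s *ₚ H → c ℚ.- σ ℚ.- ℕ→ℚ s ≢ 0ℚ → eval H 1ℚ ≡ 0ℚ
  L≋0⇒cofactor[1]≡0 y s H Ly≋0 y≋ c-σ-s≢0 =
    x*y≡0⇒y≡0 (ℕ→ℚ-≢0 {suc s} λ ()) (x*y≡0⇒y≡0 c-σ-s≢0 (trans (sym eval-V) (eval-≋[] 1ℚ V≋0)))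
    where
    V : Poly
    V = proj₁ (L-U^ₚ-suc-*ₚ s H)
    L≋ : L (U ^ₚ suc s *ₚ H) ≋ U ^ₚ s *ₚ V
    L≋ = proj₁ (proj₂ (L-U^ₚ-suc-*ₚ s H))
    eval-V : eval V 1ℚ ≡ (c ℚ.- σ ℚ.- ℕ→ℚ s) ℚ.* (ℕ→ℚ (suc s) ℚ.* eval H 1ℚ)
    eval-V = proj₂ (proj₂ (L-U^ₚ-suc-*ₚ s H))
    V≋0 : V ≋ []
    V≋0 = U^ₚ-*ₚ-cancelˡ s (≋-trans (≋-sym L≋) (≋-trans (≋-sym (L-cong y≋)) (≋-trans Ly≋0 (≋-sym (*ₚ-zeroʳ (U ^ₚ s))))))

coeff-applyUpTo-< : ∀ n f j → j < n → coeff (applyUpTo f n) j ≡ f j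
coeff-applyUpTo-< (suc n) f zero    _         = refl
coeff-applyUpTo-< (suc n) f (suc j) (s≤s j<n) = coeff-applyUpTo-< n (f ∘ suc) j j<n

coeff-applyUpTo-≥ : ∀ n f j → n ≤ j → coeff (applyUpTo f n) j ≡ 0ℚ
coeff-applyUpTo-≥ zero    f j       _         = refl
coeff-applyUpTo-≥ (suc n) f (suc j) (s≤s n≤j) = coeff-applyUpTo-≥ n (f ∘ suc) j n≤j

applyUpTo-suc : ∀ n f → applyUpTo f (suc n) ≋ applyUpTo f n +ₚ f n ·ₚ X ^ₚ n
applyUpTo-suc zero    f = mk≋ λ { zero → sym (ℚP.*-identityʳ (f 0)) ; (suc n) → refl }
applyUpTo-suc (suc m) f = ≋-trans (∷-cong refl (applyUpTo-suc m (f ∘ suc)))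
  (≋-sym (≋-trans (+ₚ-congˡ (applyUpTo f (suc m)) (·ₚ-X-*ₚ (f (suc m)) (X ^ₚ m))) (∷-cong (ℚP.+-identityʳ (f 0)) ≋-refl)))

sumPoly≋applyUpTo : ∀ n c → sumPoly n c (λ i → i) ≋ applyUpTo c (suc n)
sumPoly≋applyUpTo zero    c = ≋-sym (applyUpTo-suc zero c)
sumPoly≋applyUpTo (suc n) c =
  ≋-trans (+ₚ-congʳ (c (suc n) ·ₚ X ^ₚ suc n) (sumPoly≋applyUpTo n c)) (≋-sym (applyUpTo-suc (suc n) c))

sumPoly-reversed : ∀ k n c → n ≤ k → sumPoly n c (k ∸_) ≋ X ^ₚ (k ∸ n) *ₚ applyUpTo (λ t → c (n ∸ t)) (suc n)
sumPoly-reversed k zero    c _ = ≋-trans (·ₚ≋constₚ-*ₚ (c 0) (X ^ₚ k)) (*ₚ-comm (constₚ (c 0)) (X ^ₚ k))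
sumPoly-reversed k (suc m) c m<k = begin
  sumPoly m c (k ∸_) +ₚ c (suc m) ·ₚ X ^ₚ (k ∸ suc m)
    ≈⟨ +ₚ-cong (sumPoly-reversed k m c (ℕP.<⇒≤ m<k)) (·ₚ≋constₚ-*ₚ (c (suc m)) (X ^ₚ (k ∸ suc m))) ⟩
  X ^ₚ (k ∸ m) *ₚ F +ₚ constₚ (c (suc m)) *ₚ X ^ₚ (k ∸ suc m)
    ≡⟨ cong (λ e → X ^ₚ e *ₚ F +ₚ constₚ (c (suc m)) *ₚ X ^ₚ (k ∸ suc m)) (ℕP.+-∸-assoc 1 m<k) ⟩
  X *ₚ X ^ₚ (k ∸ suc m) *ₚ F +ₚ constₚ (c (suc m)) *ₚ X ^ₚ (k ∸ suc m)
    ≈⟨ psolve 4 (λ x p f a → x ⊗ p ⊗ f ⊕ a ⊗ p ⊜ p ⊗ (a ⊕ x ⊗ f)) ≋-refl X (X ^ₚ (k ∸ suc m)) F (constₚ (c (suc m))) ⟩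
  X ^ₚ (k ∸ suc m) *ₚ (constₚ (c (suc m)) +ₚ X *ₚ F)
    ≈⟨ *ₚ-congˡ (X ^ₚ (k ∸ suc m)) (∷≋constₚ+X*ₚ (c (suc m)) F) ⟨
  X ^ₚ (k ∸ suc m) *ₚ applyUpTo (λ t → c (suc m ∸ t)) (suc (suc m))
    ∎
  where
  open ≋-Reasoning
  F : Poly
  F = applyUpTo (λ t → c (m ∸ t)) (suc m)

eval-·ₚ-X^ₚ-1 : ∀ b m → eval (b ·ₚ X ^ₚ m) 1ℚ ≡ b
eval-·ₚ-X^ₚ-1 b m = trans (eval-· b (X ^ₚ m) 1ℚ) (trans (cong (b ℚ.*_) (eval-^ₚ-1 {X} {1ℚ} (eval-X 1ℚ) m)) (ℚP.*-identityʳ b))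

eval-sumPoly-1 : ∀ n c e e′ → eval (sumPoly n c e) 1ℚ ≡ eval (sumPoly n c e′) 1ℚ
eval-sumPoly-1 zero    c e e′ = trans (eval-·ₚ-X^ₚ-1 (c 0) (e 0)) (sym (eval-·ₚ-X^ₚ-1 (c 0) (e′ 0)))
eval-sumPoly-1 (suc n) c e e′ = begin
  eval (sumPoly n c e +ₚ c (suc n) ·ₚ X ^ₚ e (suc n)) 1ℚ
    ≡⟨ eval-+ (sumPoly n c e) (c (suc n) ·ₚ X ^ₚ e (suc n)) 1ℚ ⟩
  eval (sumPoly n c e) 1ℚ ℚ.+ eval (c (suc n) ·ₚ X ^ₚ e (suc n)) 1ℚ
    ≡⟨ cong₂ ℚ._+_ (eval-sumPoly-1 n c e e′)
                   (trans (eval-·ₚ-X^ₚ-1 (c (suc n)) (e (suc n))) (sym (eval-·ₚ-X^ₚ-1 (c (suc n)) (e′ (suc n))))) ⟩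
  eval (sumPoly n c e′) 1ℚ ℚ.+ eval (c (suc n) ·ₚ X ^ₚ e′ (suc n)) 1ℚ
    ≡⟨ eval-+ (sumPoly n c e′) (c (suc n) ·ₚ X ^ₚ e′ (suc n)) 1ℚ ⟨
  eval (sumPoly n c e′ +ₚ c (suc n) ·ₚ X ^ₚ e′ (suc n)) 1ℚ
    ∎
  where open ≡-Reasoning

Bezout : Poly → Poly → Set
Bezout p q = Σ Poly λ A → Σ Poly λ B → A *ₚ p +ₚ B *ₚ q ≋ constₚ 1ℚ

Bezout-remainder : ∀ {p q} s c → c ≢ 0ℚ → p ≋ q *ₚ s +ₚ constₚ c → Bezout p q
Bezout-remainder {p} {q} s c c≢0 p≋ = constₚ c⁻¹ , -ₚ (constₚ c⁻¹ *ₚ s) , (begin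
  constₚ c⁻¹ *ₚ p +ₚ (-ₚ (constₚ c⁻¹ *ₚ s)) *ₚ q
    ≈⟨ +ₚ-congʳ ((-ₚ (constₚ c⁻¹ *ₚ s)) *ₚ q) (*ₚ-congˡ (constₚ c⁻¹) p≋) ⟩
  constₚ c⁻¹ *ₚ (q *ₚ s +ₚ constₚ c) +ₚ (-ₚ (constₚ c⁻¹ *ₚ s)) *ₚ q
    ≈⟨ psolve 4 (λ i q s c → i ⊗ (q ⊗ s ⊕ c) ⊕ (⊝ (i ⊗ s)) ⊗ q ⊜ i ⊗ c) ≋-refl (constₚ c⁻¹) q s (constₚ c) ⟩
  constₚ c⁻¹ *ₚ constₚ c
    ≈⟨ constₚ-homo-* c⁻¹ c ⟨
  constₚ (c⁻¹ ℚ.* c)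
    ≡⟨ cong constₚ (ℚP.*-inverseˡ c) ⟩
  constₚ 1ℚ
    ∎)
  where
  open ≋-Reasoning
  instance _ = ℚ.≢-nonZero c≢0
  c⁻¹ : ℚ
  c⁻¹ = ℚ.1/ c

Bezout-*ʳ : ∀ {p q r} → Bezout p q → Bezout p r → Bezout p (q *ₚ r)
Bezout-*ʳ {p} {q} {r} (A , B , Ap+Bq≋1) (A′ , B′ , A′p+B′r≋1) =
  A *ₚ A′ *ₚ p +ₚ A *ₚ B′ *ₚ r +ₚ B *ₚ q *ₚ A′ , B *ₚ B′ , (begin
    (A *ₚ A′ *ₚ p +ₚ A *ₚ B′ *ₚ r +ₚ B *ₚ q *ₚ A′) *ₚ p +ₚ B *ₚ B′ *ₚ (q *ₚ r)
      ≈⟨ psolve 7 (λ A B A′ B′ p q r → (A ⊗ A′ ⊗ p ⊕ A ⊗ B′ ⊗ r ⊕ B ⊗ q ⊗ A′) ⊗ p ⊕ B ⊗ B′ ⊗ (q ⊗ r)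
                                       ⊜ (A ⊗ p ⊕ B ⊗ q) ⊗ (A′ ⊗ p ⊕ B′ ⊗ r))
                  ≋-refl A B A′ B′ p q r ⟩
    (A *ₚ p +ₚ B *ₚ q) *ₚ (A′ *ₚ p +ₚ B′ *ₚ r)
      ≈⟨ *ₚ-cong Ap+Bq≋1 A′p+B′r≋1 ⟩
    constₚ 1ℚ *ₚ constₚ 1ℚ
      ≈⟨ *ₚ-identityˡ (constₚ 1ℚ) ⟩
    constₚ 1ℚ
      ∎)
  where open ≋-Reasoning

Bezout-^ʳ : ∀ {p q} → Bezout p q → ∀ n → Bezout p (q ^ₚ n)
Bezout-^ʳ {p} {q} _   zero    = [] , constₚ 1ℚ , *ₚ-identityˡ (constₚ 1ℚ)
Bezout-^ʳ {p} {q} pq (suc n) = Bezout-*ʳ pq (Bezout-^ʳ pq n)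

-- A D + B T = 1 with N'D - ND' = c T gives (-B'D') N + (A + B'N') D = 1 for B' = B/c.
Bezout-Wronskian : ∀ {N D T} c → c ≢ 0ℚ → W[ N , D ] ≋ c ·ₚ T → Bezout D T → Bezout N D
Bezout-Wronskian {N} {D} {T} c c≢0 W≋cT (A , B , AD+BT≋1) = -ₚ (B′ *ₚ deriv D) , A +ₚ B′ *ₚ deriv N , (begin
  (-ₚ (B′ *ₚ deriv D)) *ₚ N +ₚ (A +ₚ B′ *ₚ deriv N) *ₚ D
    ≈⟨ psolve 6 (λ A B′ N D N′ D′ → (⊝ (B′ ⊗ D′)) ⊗ N ⊕ (A ⊕ B′ ⊗ N′) ⊗ D ⊜ A ⊗ D ⊕ B′ ⊗ (N′ ⊗ D ⊖ N ⊗ D′))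
                ≋-refl A B′ N D (deriv N) (deriv D) ⟩
  A *ₚ D +ₚ B′ *ₚ W[ N , D ]
    ≈⟨ +ₚ-congˡ (A *ₚ D) (*ₚ-congˡ B′ (≋-trans W≋cT (·ₚ≋constₚ-*ₚ c T))) ⟩
  A *ₚ D +ₚ B *ₚ constₚ c⁻¹ *ₚ (constₚ c *ₚ T)
    ≈⟨ +ₚ-congˡ (A *ₚ D) (psolve 4 (λ B i c T → B ⊗ i ⊗ (c ⊗ T) ⊜ B ⊗ (i ⊗ c) ⊗ T) ≋-refl B (constₚ c⁻¹) (constₚ c) T) ⟩
  A *ₚ D +ₚ B *ₚ (constₚ c⁻¹ *ₚ constₚ c) *ₚ T
    ≈⟨ +ₚ-congˡ (A *ₚ D) (*ₚ-congʳ T (*ₚ-congˡ B (≋-trans (≋-sym (constₚ-homo-* c⁻¹ c)) (≡⇒≋ (cong constₚ (ℚP.*-inverseˡ c)))))) ⟩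
  A *ₚ D +ₚ B *ₚ constₚ 1ℚ *ₚ T
    ≈⟨ +ₚ-congˡ (A *ₚ D) (*ₚ-congʳ T (*ₚ-identityʳ B)) ⟩
  A *ₚ D +ₚ B *ₚ T
    ≈⟨ AD+BT≋1 ⟩
  constₚ 1ℚ
    ∎)
  where
  open ≋-Reasoning
  instance _ = ℚ.≢-nonZero c≢0
  c⁻¹ : ℚ
  c⁻¹ = ℚ.1/ c
  B′ : Poly
  B′ = B *ₚ constₚ c⁻¹

-- The map of Proposition 3.4

module BelyiMap (d k : ℕ) (2k+1≤d : 2 * k + 1 ≤ d) where

  B : ℕ → ℚ
  B i = signed i (coefA d k i)

  D P N : Poly
  D = belyiDen d k
  P = sumPoly k B (k ∸_)
  N = belyiNum d k

  k<d : k < d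
  k<d = ℕP.≤-trans (s≤s (ℕP.m≤m+n k (k + 0))) (subst (_≤ d) (ℕP.+-comm (2 * k) 1) 2k+1≤d)

  B-zero : ∀ i → k < i → B i ≡ 0ℚ
  B-zero i k<i = trans (cong (signed i) (coefA-zero d k i k<i)) (signed-0 i)

  B-≢0 : ∀ i → i ≤ k → B i ≢ 0ℚ
  B-≢0 i i≤k = signed-≢0 i (ℕP.n>0⇒n≢0 (coefA-pos d k i i≤k 2k+1≤d))

  coeff-D : ∀ j → coeff D j ≡ B j
  coeff-D j with ℕP.≤-<-connex j k
  ... | inj₁ j≤k = trans (get (sumPoly≋applyUpTo k B) j) (coeff-applyUpTo-< (suc k) B j (s≤s j≤k))
  ... | inj₂ k<j = trans (get (sumPoly≋applyUpTo k B) j) (trans (coeff-applyUpTo-≥ (suc k) B j k<j) (sym (B-zero j k<j)))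

  P≋ : P ≋ applyUpTo (λ t → B (k ∸ t)) (suc k)
  P≋ = ≋-trans (sumPoly-reversed k k B ℕP.≤-refl)
               (subst (λ e → X ^ₚ e *ₚ F ≋ F) (sym (ℕP.n∸n≡0 k)) (*ₚ-identityˡ F))
    where F = applyUpTo (λ t → B (k ∸ t)) (suc k)

  coeff-P-≤ : ∀ j → j ≤ k → coeff P j ≡ B (k ∸ j)
  coeff-P-≤ j j≤k = trans (get P≋ j) (coeff-applyUpTo-< (suc k) (λ t → B (k ∸ t)) j (s≤s j≤k))

  coeff-P-> : ∀ j → k < j → coeff P j ≡ 0ℚ
  coeff-P-> j k<j = trans (get P≋ j) (coeff-applyUpTo-≥ (suc k) (λ t → B (k ∸ t)) j k<j)

  d∸[d∸k]≡k : d ∸ (d ∸ k) ≡ k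
  d∸[d∸k]≡k = ℕP.m∸[m∸n]≡n (ℕP.<⇒≤ k<d)

  coeff-N-≤ : ∀ j → j ≤ d → coeff N j ≡ B (d ∸ j)
  coeff-N-≤ j j≤d with ℕP.<-≤-connex j (d ∸ k)
  ... | inj₁ j<d∸k = trans (coeff-X^ₚ-*ₚ-< (d ∸ k) P j j<d∸k) (sym (B-zero (d ∸ j) k<d∸j))
    where
    k<d∸j : k < d ∸ j
    k<d∸j = subst (_< d ∸ j) d∸[d∸k]≡k (ℕP.∸-monoʳ-< j<d∸k (ℕP.m∸n≤m d k))
  ... | inj₂ d∸k≤j = begin
    coeff N j                        ≡⟨ cong (coeff N) (ℕP.m+[n∸m]≡n d∸k≤j) ⟨
    coeff N (d ∸ k + (j ∸ (d ∸ k)))  ≡⟨ coeff-X^ₚ-*ₚ (d ∸ k) P (j ∸ (d ∸ k)) ⟩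
    coeff P (j ∸ (d ∸ k))            ≡⟨ coeff-P-≤ (j ∸ (d ∸ k)) (subst (j ∸ (d ∸ k) ≤_) d∸[d∸k]≡k (ℕP.∸-monoˡ-≤ (d ∸ k) j≤d)) ⟩
    B (k ∸ (j ∸ (d ∸ k)))            ≡⟨ cong B index≡ ⟩
    B (d ∸ j)                        ∎
    where
    open ≡-Reasoning
    index≡ : k ∸ (j ∸ (d ∸ k)) ≡ d ∸ j
    index≡ = begin
      k ∸ (j ∸ (d ∸ k))                  ≡⟨ cong (_∸ (j ∸ (d ∸ k))) d∸[d∸k]≡k ⟨
      d ∸ (d ∸ k) ∸ (j ∸ (d ∸ k))        ≡⟨ ℕP.∸-+-assoc d (d ∸ k) (j ∸ (d ∸ k)) ⟩
      d ∸ (d ∸ k + (j ∸ (d ∸ k)))        ≡⟨ cong (d ∸_) (ℕP.m+[n∸m]≡n d∸k≤j) ⟩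
      d ∸ j                              ∎

  coeff-N-> : ∀ j → d < j → coeff N j ≡ 0ℚ
  coeff-N-> j d<j = begin
    coeff N j                        ≡⟨ cong (coeff N) (ℕP.m+[n∸m]≡n d∸k≤j) ⟨
    coeff N (d ∸ k + (j ∸ (d ∸ k)))  ≡⟨ coeff-X^ₚ-*ₚ (d ∸ k) P (j ∸ (d ∸ k)) ⟩
    coeff P (j ∸ (d ∸ k))            ≡⟨ coeff-P-> (j ∸ (d ∸ k)) (subst (_< j ∸ (d ∸ k)) d∸[d∸k]≡k (ℕP.∸-monoˡ-< d<j (ℕP.m∸n≤m d k))) ⟩
    0ℚ                               ∎
    where
    open ≡-Reasoning
    d∸k≤j : d ∸ k ≤ j
    d∸k≤j = ℕP.≤-trans (ℕP.m∸n≤m d k) (ℕP.<⇒≤ d<j)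

  N-degree : DegreeIs N d
  N-degree = (λ N[d]≡0 → B-≢0 0 z≤n (trans (cong B (sym (ℕP.n∸n≡0 d))) (trans (sym (coeff-N-≤ d ℕP.≤-refl)) N[d]≡0)))
           , coeff-N->

  D-degree : DegreeIs D k
  D-degree = (λ D[k]≡0 → B-≢0 k ℕP.≤-refl (trans (sym (coeff-D k)) D[k]≡0))
           , λ m k<m → trans (coeff-D m) (B-zero m k<m)

  D[0]≢0 : coeff D 0 ≢ 0ℚ
  D[0]≢0 D[0]≡0 = B-≢0 0 z≤n (trans (sym (coeff-D 0)) D[0]≡0)

  P[0]≢0 : eval P 0ℚ ≢ 0ℚ
  P[0]≢0 P[0]≡0 = B-≢0 k ℕP.≤-refl (trans (sym (coeff-P-≤ 0 z≤n)) (trans (sym (eval-0 P)) P[0]≡0))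

  kq dq : ℚ
  kq = ℕ→ℚ k
  dq = ℕ→ℚ d

  a : ℕ
  a = d ∸ k ∸ 1

  k<d∸k : k < d ∸ k
  k<d∸k = ℕP.m+n≤o⇒m≤o∸n (suc k) (subst (_≤ d) (ℕ-solve 1 (λ k → ℕ-con 2 ⊠ k ⊞ ℕ-con 1 ≐ ℕ-con 1 ⊞ k ⊞ k) refl k) 2k+1≤d)

  d∸k≡1+a : d ∸ k ≡ suc a
  d∸k≡1+a = sym (ℕP.m+[n∸m]≡n (ℕP.≤-trans (s≤s z≤n) k<d∸k))

  a≡d-k-1 : ℕ→ℚ a ≡ dq ℚ.- kq ℚ.- 1ℚ
  a≡d-k-1 = trans (ℕ→ℚ-homo-∸ (ℕP.≤-trans (s≤s z≤n) k<d∸k)) (cong (ℚ._- 1ℚ) (ℕ→ℚ-homo-∸ (ℕP.<⇒≤ k<d)))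

  top≡d-k-i-1 : ∀ i → i < k → ℕ→ℚ (top d k i) ≡ dq ℚ.- kq ℚ.- ℕ→ℚ i ℚ.- 1ℚ
  top≡d-k-i-1 i i<k = trans (ℕ→ℚ-homo-∸ (ℕP.m<n⇒0<n∸m i<d∸k))
    (cong (ℚ._- 1ℚ) (trans (ℕ→ℚ-homo-∸ (ℕP.<⇒≤ i<d∸k)) (cong (ℚ._- ℕ→ℚ i) (ℕ→ℚ-homo-∸ (ℕP.<⇒≤ k<d)))))
    where
    i<d∸k : i < d ∸ k
    i<d∸k = ℕP.<-trans i<k k<d∸k

  B-recurrence : ∀ i → ℕ→ℚ (suc i) ℚ.* (dq ℚ.- kq ℚ.- ℕ→ℚ i ℚ.- 1ℚ) ℚ.* B (suc i)
                       ≡ ℚ.- ((dq ℚ.- ℕ→ℚ i) ℚ.* (kq ℚ.- ℕ→ℚ i) ℚ.* B i)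
  B-recurrence i with ℕP.<-cmp i k
  ... | tri< i<k _ _ = begin
    i₁ ℚ.* (dq ℚ.- kq ℚ.- iq ℚ.- 1ℚ) ℚ.* B (suc i)
      ≡⟨ cong₂ (λ u v → i₁ ℚ.* u ℚ.* v) (sym (top≡d-k-i-1 i i<k)) (signed≡ (suc i) a₁) ⟩
    i₁ ℚ.* ℕ→ℚ (top d k i) ℚ.* ((ℚ.- s) ℚ.* ℕ→ℚ a₁)
      ≡⟨ solve 4 (λ i₁ t s a → i₁ :* t :* ((:- s) :* a) := :- (s :* (a :* i₁ :* t))) refl i₁ (ℕ→ℚ (top d k i)) s (ℕ→ℚ a₁) ⟩
    ℚ.- (s ℚ.* (ℕ→ℚ a₁ ℚ.* i₁ ℚ.* ℕ→ℚ (top d k i)))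
      ≡⟨ cong (λ z → ℚ.- (s ℚ.* z)) (trans (sym (ℕ→ℚ-homo-*³ a₁ (suc i) (top d k i)))
                                          (trans (cong ℕ→ℚ (coefA-recurrence d k i i<k)) (ℕ→ℚ-homo-*³ a₀ (d ∸ i) (k ∸ i)))) ⟩
    ℚ.- (s ℚ.* (ℕ→ℚ a₀ ℚ.* ℕ→ℚ (d ∸ i) ℚ.* ℕ→ℚ (k ∸ i)))
      ≡⟨ cong₂ (λ u v → ℚ.- (s ℚ.* (ℕ→ℚ a₀ ℚ.* u ℚ.* v)))
               (ℕ→ℚ-homo-∸ (ℕP.<⇒≤ (ℕP.<-trans i<k k<d))) (ℕ→ℚ-homo-∸ (ℕP.<⇒≤ i<k)) ⟩
    ℚ.- (s ℚ.* (ℕ→ℚ a₀ ℚ.* (dq ℚ.- iq) ℚ.* (kq ℚ.- iq)))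
      ≡⟨ solve 4 (λ s a u v → :- (s :* (a :* u :* v)) := :- (u :* v :* (s :* a))) refl s (ℕ→ℚ a₀) (dq ℚ.- iq) (kq ℚ.- iq) ⟩
    ℚ.- ((dq ℚ.- iq) ℚ.* (kq ℚ.- iq) ℚ.* (s ℚ.* ℕ→ℚ a₀))
      ≡⟨ cong (λ z → ℚ.- ((dq ℚ.- iq) ℚ.* (kq ℚ.- iq) ℚ.* z)) (signed≡ i a₀) ⟨
    ℚ.- ((dq ℚ.- iq) ℚ.* (kq ℚ.- iq) ℚ.* B i)
      ∎
    where
    open ≡-Reasoning
    iq i₁ s : ℚ
    iq = ℕ→ℚ i
    i₁ = ℕ→ℚ (suc i)
    s = signed i 1
    a₀ a₁ : ℕ
    a₀ = coefA d k i
    a₁ = coefA d k (suc i)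
  ... | tri≈ _ refl _ = begin
    ℕ→ℚ (suc k) ℚ.* (dq ℚ.- kq ℚ.- kq ℚ.- 1ℚ) ℚ.* B (suc k)
      ≡⟨ cong (ℕ→ℚ (suc k) ℚ.* (dq ℚ.- kq ℚ.- kq ℚ.- 1ℚ) ℚ.*_) (B-zero (suc k) ℕP.≤-refl) ⟩
    ℕ→ℚ (suc k) ℚ.* (dq ℚ.- kq ℚ.- kq ℚ.- 1ℚ) ℚ.* 0ℚ
      ≡⟨ solve 4 (λ n d k b → n :* (d :- k :- k :- con 1ℚ) :* con 0ℚ := :- ((d :- k) :* (k :- k) :* b))
                 refl (ℕ→ℚ (suc k)) dq kq (B k) ⟩
    ℚ.- ((dq ℚ.- kq) ℚ.* (kq ℚ.- kq) ℚ.* B k)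
      ∎
    where open ≡-Reasoning
  ... | tri> _ _ k<i = begin
    ℕ→ℚ (suc i) ℚ.* (dq ℚ.- kq ℚ.- ℕ→ℚ i ℚ.- 1ℚ) ℚ.* B (suc i)
      ≡⟨ cong (ℕ→ℚ (suc i) ℚ.* (dq ℚ.- kq ℚ.- ℕ→ℚ i ℚ.- 1ℚ) ℚ.*_) (B-zero (suc i) (ℕP.m<n⇒m<1+n k<i)) ⟩
    ℕ→ℚ (suc i) ℚ.* (dq ℚ.- kq ℚ.- ℕ→ℚ i ℚ.- 1ℚ) ℚ.* 0ℚ
      ≡⟨ solve 3 (λ x y z → x :* y :* con 0ℚ := :- (z :* con 0ℚ)) refl (ℕ→ℚ (suc i)) (dq ℚ.- kq ℚ.- ℕ→ℚ i ℚ.- 1ℚ) ((dq ℚ.- ℕ→ℚ i) ℚ.* (kq ℚ.- ℕ→ℚ i)) ⟩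
    ℚ.- ((dq ℚ.- ℕ→ℚ i) ℚ.* (kq ℚ.- ℕ→ℚ i) ℚ.* 0ℚ)
      ≡⟨ cong (λ z → ℚ.- ((dq ℚ.- ℕ→ℚ i) ℚ.* (kq ℚ.- ℕ→ℚ i) ℚ.* z)) (B-zero i k<i) ⟨
    ℚ.- ((dq ℚ.- ℕ→ℚ i) ℚ.* (kq ℚ.- ℕ→ℚ i) ℚ.* B i)
      ∎
    where open ≡-Reasoning

  open Hypergeometric (ℚ.- kq) (ℚ.- dq) (ℚ.- ℕ→ℚ a)

  D-recurrence : Recurrence D
  D-recurrence n = begin
    n₁ ℚ.* (nq ℚ.+ ℚ.- ℕ→ℚ a) ℚ.* coeff D (suc n)
      ≡⟨ cong₂ (λ u v → n₁ ℚ.* (nq ℚ.+ ℚ.- u) ℚ.* v) a≡d-k-1 (coeff-D (suc n)) ⟩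
    n₁ ℚ.* (nq ℚ.+ ℚ.- (dq ℚ.- kq ℚ.- 1ℚ)) ℚ.* B (suc n)
      ≡⟨ solve 5 (λ n₁ n d k b → n₁ :* (n :+ :- (d :- k :- con 1ℚ)) :* b := :- (n₁ :* (d :- k :- n :- con 1ℚ) :* b)) refl n₁ nq dq kq (B (suc n)) ⟩
    ℚ.- (n₁ ℚ.* (dq ℚ.- kq ℚ.- nq ℚ.- 1ℚ) ℚ.* B (suc n))
      ≡⟨ cong ℚ.-_ (B-recurrence n) ⟩
    ℚ.- (ℚ.- ((dq ℚ.- nq) ℚ.* (kq ℚ.- nq) ℚ.* B n))
      ≡⟨ solve 4 (λ n d k b → :- (:- ((d :- n) :* (k :- n) :* b)) := (n :+ :- k) :* (n :+ :- d) :* b) refl nq dq kq (B n) ⟩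
    (nq ℚ.+ ℚ.- kq) ℚ.* (nq ℚ.+ ℚ.- dq) ℚ.* B n
      ≡⟨ cong ((nq ℚ.+ ℚ.- kq) ℚ.* (nq ℚ.+ ℚ.- dq) ℚ.*_) (coeff-D n) ⟨
    (nq ℚ.+ ℚ.- kq) ℚ.* (nq ℚ.+ ℚ.- dq) ℚ.* coeff D n
      ∎
    where
    open ≡-Reasoning
    nq n₁ : ℚ
    nq = ℕ→ℚ n
    n₁ = ℕ→ℚ (suc n)

  -- N has coefficient B (d - n) at xⁿ; for d = n + 1 + i the recurrence of B at i is that of N at n.
  B-recurrence-reflected : ∀ n i d {b b′} → d ≡ n ℚ.+ 1ℚ ℚ.+ i →
                           (1ℚ ℚ.+ i) ℚ.* (d ℚ.- kq ℚ.- i ℚ.- 1ℚ) ℚ.* b′ ≡ ℚ.- ((d ℚ.- i) ℚ.* (kq ℚ.- i) ℚ.* b) →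
                           (1ℚ ℚ.+ n) ℚ.* (n ℚ.+ ℚ.- (d ℚ.- kq ℚ.- 1ℚ)) ℚ.* b ≡ (n ℚ.+ ℚ.- kq) ℚ.* (n ℚ.+ ℚ.- d) ℚ.* b′
  B-recurrence-reflected n i _ {b} {b′} refl rec = begin
    (1ℚ ℚ.+ n) ℚ.* (n ℚ.+ ℚ.- (n ℚ.+ 1ℚ ℚ.+ i ℚ.- kq ℚ.- 1ℚ)) ℚ.* b
      ≡⟨ solve 4 (λ n i k b → (con 1ℚ :+ n) :* (n :+ :- (n :+ con 1ℚ :+ i :- k :- con 1ℚ)) :* b
                             := :- (:- ((n :+ con 1ℚ :+ i :- i) :* (k :- i) :* b))) refl n i kq b ⟩
    ℚ.- (ℚ.- ((n ℚ.+ 1ℚ ℚ.+ i ℚ.- i) ℚ.* (kq ℚ.- i) ℚ.* b))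
      ≡⟨ cong ℚ.-_ rec ⟨
    ℚ.- ((1ℚ ℚ.+ i) ℚ.* (n ℚ.+ 1ℚ ℚ.+ i ℚ.- kq ℚ.- i ℚ.- 1ℚ) ℚ.* b′)
      ≡⟨ solve 4 (λ n i k b′ → :- ((con 1ℚ :+ i) :* (n :+ con 1ℚ :+ i :- k :- i :- con 1ℚ) :* b′)
                              := (n :+ :- k) :* (n :+ :- (n :+ con 1ℚ :+ i)) :* b′) refl n i kq b′ ⟩
    (n ℚ.+ ℚ.- kq) ℚ.* (n ℚ.+ ℚ.- (n ℚ.+ 1ℚ ℚ.+ i)) ℚ.* b′
      ∎
    where open ≡-Reasoning

  N-recurrence-< : ∀ n → n < d → ℕ→ℚ (suc n) ℚ.* (ℕ→ℚ n ℚ.+ ℚ.- ℕ→ℚ a) ℚ.* coeff N (suc n)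
                                   ≡ (ℕ→ℚ n ℚ.+ ℚ.- kq) ℚ.* (ℕ→ℚ n ℚ.+ ℚ.- dq) ℚ.* coeff N n
  N-recurrence-< n n<d = begin
    n₁ ℚ.* (nq ℚ.+ ℚ.- ℕ→ℚ a) ℚ.* coeff N (suc n)
      ≡⟨ cong₂ (λ u v → n₁ ℚ.* (nq ℚ.+ ℚ.- u) ℚ.* v) a≡d-k-1 (coeff-N-≤ (suc n) n<d) ⟩
    n₁ ℚ.* (nq ℚ.+ ℚ.- (dq ℚ.- kq ℚ.- 1ℚ)) ℚ.* B i
      ≡⟨ cong (λ m → m ℚ.* (nq ℚ.+ ℚ.- (dq ℚ.- kq ℚ.- 1ℚ)) ℚ.* B i) (ℕ→ℚ-suc n) ⟩
    (1ℚ ℚ.+ nq) ℚ.* (nq ℚ.+ ℚ.- (dq ℚ.- kq ℚ.- 1ℚ)) ℚ.* B i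
      ≡⟨ B-recurrence-reflected nq (ℕ→ℚ i) dq d≡n+1+i
           (trans (cong (λ m → m ℚ.* (dq ℚ.- kq ℚ.- ℕ→ℚ i ℚ.- 1ℚ) ℚ.* B (suc i)) (sym (ℕ→ℚ-suc i))) (B-recurrence i)) ⟩
    (nq ℚ.+ ℚ.- kq) ℚ.* (nq ℚ.+ ℚ.- dq) ℚ.* B (suc i)
      ≡⟨ cong (λ j → (nq ℚ.+ ℚ.- kq) ℚ.* (nq ℚ.+ ℚ.- dq) ℚ.* B j) d∸n≡1+i ⟨
    (nq ℚ.+ ℚ.- kq) ℚ.* (nq ℚ.+ ℚ.- dq) ℚ.* B (d ∸ n)
      ≡⟨ cong ((nq ℚ.+ ℚ.- kq) ℚ.* (nq ℚ.+ ℚ.- dq) ℚ.*_) (coeff-N-≤ n (ℕP.<⇒≤ n<d)) ⟨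
    (nq ℚ.+ ℚ.- kq) ℚ.* (nq ℚ.+ ℚ.- dq) ℚ.* coeff N n
      ∎
    where
    open ≡-Reasoning
    nq n₁ : ℚ
    nq = ℕ→ℚ n
    n₁ = ℕ→ℚ (suc n)
    i : ℕ
    i = d ∸ suc n
    d∸n≡1+i : d ∸ n ≡ suc i
    d∸n≡1+i = ℕP.+-∸-assoc 1 n<d
    d≡n+1+i : dq ≡ nq ℚ.+ 1ℚ ℚ.+ ℕ→ℚ i
    d≡n+1+i = begin
      ℕ→ℚ d                         ≡⟨ cong ℕ→ℚ (ℕP.m+[n∸m]≡n n<d) ⟨
      ℕ→ℚ (suc n + i)               ≡⟨ ℕ→ℚ-homo-+ (suc n) i ⟩
      ℕ→ℚ (suc n) ℚ.+ ℕ→ℚ i         ≡⟨ cong (ℚ._+ ℕ→ℚ i) (trans (ℕ→ℚ-suc n) (ℚP.+-comm 1ℚ nq)) ⟩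
      nq ℚ.+ 1ℚ ℚ.+ ℕ→ℚ i           ∎

  N-recurrence : Recurrence N
  N-recurrence n with ℕP.<-cmp n d
  ... | tri< n<d _ _ = N-recurrence-< n n<d
  ... | tri≈ _ refl _ = begin
    ℕ→ℚ (suc d) ℚ.* (dq ℚ.+ ℚ.- ℕ→ℚ a) ℚ.* coeff N (suc d)
      ≡⟨ cong (ℕ→ℚ (suc d) ℚ.* (dq ℚ.+ ℚ.- ℕ→ℚ a) ℚ.*_) (coeff-N-> (suc d) ℕP.≤-refl) ⟩
    ℕ→ℚ (suc d) ℚ.* (dq ℚ.+ ℚ.- ℕ→ℚ a) ℚ.* 0ℚ
      ≡⟨ solve 5 (λ n a d k y → n :* (d :+ :- a) :* con 0ℚ := (d :+ :- k) :* (d :+ :- d) :* y)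
                 refl (ℕ→ℚ (suc d)) (ℕ→ℚ a) dq kq (coeff N d) ⟩
    (dq ℚ.+ ℚ.- kq) ℚ.* (dq ℚ.+ ℚ.- dq) ℚ.* coeff N d
      ∎
    where open ≡-Reasoning
  ... | tri> _ _ d<n = begin
    ℕ→ℚ (suc n) ℚ.* (ℕ→ℚ n ℚ.+ ℚ.- ℕ→ℚ a) ℚ.* coeff N (suc n)
      ≡⟨ cong (ℕ→ℚ (suc n) ℚ.* (ℕ→ℚ n ℚ.+ ℚ.- ℕ→ℚ a) ℚ.*_) (coeff-N-> (suc n) (ℕP.m<n⇒m<1+n d<n)) ⟩
    ℕ→ℚ (suc n) ℚ.* (ℕ→ℚ n ℚ.+ ℚ.- ℕ→ℚ a) ℚ.* 0ℚ
      ≡⟨ ℚP.*-zeroʳ (ℕ→ℚ (suc n) ℚ.* (ℕ→ℚ n ℚ.+ ℚ.- ℕ→ℚ a)) ⟩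
    0ℚ
      ≡⟨ ℚP.*-zeroʳ ((ℕ→ℚ n ℚ.+ ℚ.- kq) ℚ.* (ℕ→ℚ n ℚ.+ ℚ.- dq)) ⟨
    (ℕ→ℚ n ℚ.+ ℚ.- kq) ℚ.* (ℕ→ℚ n ℚ.+ ℚ.- dq) ℚ.* 0ℚ
      ≡⟨ cong ((ℕ→ℚ n ℚ.+ ℚ.- kq) ℚ.* (ℕ→ℚ n ℚ.+ ℚ.- dq) ℚ.*_) (coeff-N-> n d<n) ⟨
    (ℕ→ℚ n ℚ.+ ℚ.- kq) ℚ.* (ℕ→ℚ n ℚ.+ ℚ.- dq) ℚ.* coeff N n
      ∎
    where open ≡-Reasoning

  L-D≋0 : L D ≋ []
  L-D≋0 = Recurrence⇒L≋0 D D-recurrence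

  L-N≋0 : L N ≋ []
  L-N≋0 = Recurrence⇒L≋0 N N-recurrence

  T : Poly
  T = X ^ₚ a *ₚ U ^ₚ (2 * k)

  σ≡ : σ ≡ ℚ.- (ℕ→ℚ a ℚ.+ ℕ→ℚ (2 * k))
  σ≡ = begin
    ℚ.- kq ℚ.+ ℚ.- dq ℚ.+ 1ℚ
      ≡⟨ solve 2 (λ k d → :- k :+ :- d :+ con 1ℚ := :- ((d :- k :- con 1ℚ) :+ (k :+ k))) refl kq dq ⟩
    ℚ.- ((dq ℚ.- kq ℚ.- 1ℚ) ℚ.+ (kq ℚ.+ kq))
      ≡⟨ cong₂ (λ u v → ℚ.- (u ℚ.+ v)) a≡d-k-1 (trans (cong ℕ→ℚ (cong (k +_) (ℕP.+-identityʳ k))) (ℕ→ℚ-homo-+ k k)) ⟨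
    ℚ.- (ℕ→ℚ a ℚ.+ ℕ→ℚ (2 * k))
      ∎
    where open ≡-Reasoning

  R≋aU+2kX : R ≋ natₚ a *ₚ U +ₚ natₚ (2 * k) *ₚ X
  R≋aU+2kX = begin
    constₚ (ℚ.- ℕ→ℚ a) -ₚ constₚ σ *ₚ X
      ≈⟨ +ₚ-congˡ (constₚ (ℚ.- ℕ→ℚ a)) (-ₚ-cong (*ₚ-congʳ X (≡⇒≋ (cong constₚ σ≡)))) ⟩
    (-ₚ natₚ a) -ₚ (-ₚ (natₚ a +ₚ natₚ (2 * k))) *ₚ X
      ≈⟨ psolve 3 (λ x A K → (⊝ A) ⊖ (⊝ (A ⊕ K)) ⊗ x ⊜ A ⊗ (x ⊖ κ 1ℚ) ⊕ K ⊗ x) ≋-refl X (natₚ a) (natₚ (2 * k)) ⟩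
    natₚ a *ₚ U +ₚ natₚ (2 * k) *ₚ X
      ∎
    where open ≋-Reasoning

  Q*T′≋ : Q *ₚ deriv T ≋ (-ₚ (natₚ a *ₚ U +ₚ natₚ (2 * k) *ₚ X)) *ₚ T
  Q*T′≋ = begin
    Q *ₚ deriv (X ^ₚ a *ₚ U²ᵏ)
      ≈⟨ *ₚ-congˡ Q (deriv-* (X ^ₚ a) U²ᵏ) ⟩
    Q *ₚ (deriv (X ^ₚ a) *ₚ U²ᵏ +ₚ X ^ₚ a *ₚ deriv U²ᵏ)
      ≈⟨ psolve 5 (λ x dXa Xa u du → (x ⊖ x ⊗ x) ⊗ (dXa ⊗ u ⊕ Xa ⊗ du)
                                     ⊜ ⊝ ((x ⊖ κ 1ℚ) ⊗ (x ⊗ dXa) ⊗ u ⊕ x ⊗ Xa ⊗ ((x ⊖ κ 1ℚ) ⊗ du)))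
                  ≋-refl X (deriv (X ^ₚ a)) (X ^ₚ a) U²ᵏ (deriv U²ᵏ) ⟩
    -ₚ (U *ₚ (X *ₚ deriv (X ^ₚ a)) *ₚ U²ᵏ +ₚ X *ₚ X ^ₚ a *ₚ (U *ₚ deriv U²ᵏ))
      ≈⟨ -ₚ-cong (+ₚ-cong (*ₚ-congʳ U²ᵏ (*ₚ-congˡ U (*ₚ-deriv-^ₚ deriv-X a)))
                          (*ₚ-congˡ (X *ₚ X ^ₚ a) (*ₚ-deriv-^ₚ deriv-U (2 * k)))) ⟩
    -ₚ (U *ₚ (natₚ a *ₚ X ^ₚ a) *ₚ U²ᵏ +ₚ X *ₚ X ^ₚ a *ₚ (natₚ (2 * k) *ₚ U²ᵏ))
      ≈⟨ psolve 5 (λ x A K Xa u → ⊝ ((x ⊖ κ 1ℚ) ⊗ (A ⊗ Xa) ⊗ u ⊕ x ⊗ Xa ⊗ (K ⊗ u))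
                                  ⊜ (⊝ (A ⊗ (x ⊖ κ 1ℚ) ⊕ K ⊗ x)) ⊗ (Xa ⊗ u))
                  ≋-refl X (natₚ a) (natₚ (2 * k)) (X ^ₚ a) U²ᵏ ⟩
    (-ₚ (natₚ a *ₚ U +ₚ natₚ (2 * k) *ₚ X)) *ₚ T
      ∎
    where
    open ≋-Reasoning
    U²ᵏ : Poly
    U²ᵏ = U ^ₚ (2 * k)

  T-equation : WEquation T
  T-equation = begin
    Q *ₚ deriv T +ₚ R *ₚ T          ≈⟨ +ₚ-cong Q*T′≋ (*ₚ-congʳ T R≋aU+2kX) ⟩
    (-ₚ S) *ₚ T +ₚ S *ₚ T           ≈⟨ psolve 2 (λ S T → (⊝ S) ⊗ T ⊕ S ⊗ T ⊜ κ 0ℚ) ≋-refl S T ⟩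
    constₚ 0ℚ                       ≈⟨ constₚ-0 ⟩
    []                              ∎
    where
    open ≋-Reasoning
    S : Poly
    S = natₚ a *ₚ U +ₚ natₚ (2 * k) *ₚ X

  W : Poly
  W = W[ N , D ]

  W-equation : WEquation W
  W-equation = L≋0⇒W-equation N D L-N≋0 L-D≋0

  cW : ℚ
  cW = ℕ→ℚ (suc a) ℚ.* B k ℚ.* B 0

  cW≢0 : cW ≢ 0ℚ
  cW≢0 = *-≢0 (*-≢0 (ℕ→ℚ-≢0 {suc a} λ ()) (B-≢0 k ℕP.≤-refl)) (B-≢0 0 z≤n)

  N≋X^[a+1]*P : N ≋ X ^ₚ suc a *ₚ P
  N≋X^[a+1]*P = ≡⇒≋ (cong (λ e → X ^ₚ e *ₚ P) d∸k≡1+a)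

  coeff-W-a : coeff W a ≡ cW
  coeff-W-a = begin
    coeff W a
      ≡⟨ get (≋-trans (W-cong N≋X^[a+1]*P ≋-refl) (W-^ₚ-suc deriv-X a P D)) a ⟩
    coeff (X ^ₚ a *ₚ (natₚ (suc a) *ₚ P *ₚ D +ₚ X *ₚ W[ P , D ])) a
      ≡⟨ coeff-X^ₚ-*ₚ-at a _ ⟩
    eval (natₚ (suc a) *ₚ P *ₚ D +ₚ X *ₚ W[ P , D ]) 0ℚ
      ≡⟨ eval-W-cofactor {X} {0ℚ} (eval-X 0ℚ) (suc a) P D W[ P , D ] ⟩
    ℕ→ℚ (suc a) ℚ.* eval P 0ℚ ℚ.* eval D 0ℚ
      ≡⟨ cong₂ (λ u v → ℕ→ℚ (suc a) ℚ.* u ℚ.* v) (trans (eval-0 P) (coeff-P-≤ 0 z≤n)) (trans (eval-0 D) (coeff-D 0)) ⟩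
    cW
      ∎
    where open ≡-Reasoning

  coeff-T-a : coeff T a ≡ 1ℚ
  coeff-T-a = trans (coeff-X^ₚ-*ₚ-at a (U ^ₚ (2 * k))) (eval-^ₚ-2* {U} {0ℚ} refl k)

  W≋cW·T : W ≋ cW ·ₚ T
  W≋cW·T = p-q≋0⇒p≋q W (cW ·ₚ T)
    (W-equation-unique a (W -ₚ cW ·ₚ T) (WEquation-linear {W} {T} cW W-equation T-equation) (ℚP.+-inverseʳ (ℕ→ℚ a)) coeff-a)
    where
    coeff-a : coeff (W -ₚ cW ·ₚ T) a ≡ 0ℚ
    coeff-a = begin
      coeff (W -ₚ cW ·ₚ T) a              ≡⟨ coeff-sub W (cW ·ₚ T) a ⟩
      coeff W a ℚ.- coeff (cW ·ₚ T) a     ≡⟨ cong₂ ℚ._-_ coeff-W-a (trans (coeff-· cW T a) (cong (cW ℚ.*_) coeff-T-a)) ⟩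
      cW ℚ.- cW ℚ.* 1ℚ                    ≡⟨ cong (λ z → cW ℚ.- z) (ℚP.*-identityʳ cW) ⟩
      cW ℚ.- cW                           ≡⟨ ℚP.+-inverseʳ cW ⟩
      0ℚ                                  ∎
      where open ≡-Reasoning

  c-σ-s≢0 : ∀ s → s < 2 * k → ℚ.- ℕ→ℚ a ℚ.- σ ℚ.- ℕ→ℚ s ≢ 0ℚ
  c-σ-s≢0 s s<2k eq = ℕP.<⇒≢ s<2k (sym (ℕ→ℚ-injective (x-y≡0⇒x≡y (begin
    ℕ→ℚ (2 * k) ℚ.- ℕ→ℚ s
      ≡⟨ solve 3 (λ a m s → m :- s := :- a :- :- (a :+ m) :- s) refl (ℕ→ℚ a) (ℕ→ℚ (2 * k)) (ℕ→ℚ s) ⟩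
    ℚ.- ℕ→ℚ a ℚ.- ℚ.- (ℕ→ℚ a ℚ.+ ℕ→ℚ (2 * k)) ℚ.- ℕ→ℚ s
      ≡⟨ cong (λ z → ℚ.- ℕ→ℚ a ℚ.- z ℚ.- ℕ→ℚ s) σ≡ ⟨
    ℚ.- ℕ→ℚ a ℚ.- σ ℚ.- ℕ→ℚ s
      ≡⟨ eq ⟩
    0ℚ
      ∎))))
    where open ≡-Reasoning

  D[1]≢0 : eval D 1ℚ ≢ 0ℚ
  D[1]≢0 D[1]≡0 = D[0]≢0 (get D≋0 0)
    where
    root : ∀ s H → s < k → D ≋ U ^ₚ suc s *ₚ H → eval H 1ℚ ≡ 0ℚ
    root s H s<k D≋ = L≋0⇒cofactor[1]≡0 D s H L-D≋0 D≋ (c-σ-s≢0 s (ℕP.<-≤-trans s<k (ℕP.m≤m+n k (k + 0))))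
    factor : Σ Poly λ H → D ≋ U ^ₚ suc k *ₚ H
    factor = divisible-by-U^ D k D[1]≡0 root
    deg-D : DegreeBelow (suc k + 0) (U ^ₚ suc k *ₚ proj₁ factor)
    deg-D = DegreeBelow-cong (proj₂ factor) λ j k+1+0≤j → trans (coeff-D j) (B-zero j (subst (_≤ j) (ℕP.+-identityʳ (suc k)) k+1+0≤j))
    D≋0 : D ≋ []
    D≋0 = begin
      D                                 ≈⟨ proj₂ factor ⟩
      U ^ₚ suc k *ₚ proj₁ factor        ≈⟨ *ₚ-congˡ (U ^ₚ suc k) (mk≋ λ j → DegreeBelow-U^ₚ-*ₚ (suc k) 0 (proj₁ factor) deg-D j z≤n) ⟩
      U ^ₚ suc k *ₚ []                  ≈⟨ *ₚ-zeroʳ (U ^ₚ suc k) ⟩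
      []                                ∎
      where open ≋-Reasoning

  E : Poly
  E = N -ₚ D

  E[1]≡0 : eval E 1ℚ ≡ 0ℚ
  E[1]≡0 = begin
    eval (N -ₚ D) 1ℚ                              ≡⟨ eval-sub N D 1ℚ ⟩
    eval N 1ℚ ℚ.- eval D 1ℚ                       ≡⟨ cong (ℚ._- eval D 1ℚ) N[1]≡D[1] ⟩
    eval D 1ℚ ℚ.- eval D 1ℚ                       ≡⟨ ℚP.+-inverseʳ (eval D 1ℚ) ⟩
    0ℚ                                            ∎
    where
    open ≡-Reasoning
    N[1]≡D[1] : eval N 1ℚ ≡ eval D 1ℚ
    N[1]≡D[1] = trans (eval-* (X ^ₚ (d ∸ k)) P 1ℚ)
      (trans (cong (ℚ._* eval P 1ℚ) (eval-^ₚ-1 {X} {1ℚ} (eval-X 1ℚ) (d ∸ k)))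
      (trans (ℚP.*-identityˡ (eval P 1ℚ)) (eval-sumPoly-1 k B (k ∸_) (λ i → i))))

  W[E,D]≋W : W[ E , D ] ≋ W
  W[E,D]≋W = begin
    deriv (N -ₚ D) *ₚ D -ₚ (N -ₚ D) *ₚ deriv D
      ≈⟨ +ₚ-congʳ (-ₚ ((N -ₚ D) *ₚ deriv D)) (*ₚ-congʳ D (deriv-sub N D)) ⟩
    (deriv N -ₚ deriv D) *ₚ D -ₚ (N -ₚ D) *ₚ deriv D
      ≈⟨ psolve 4 (λ n d n′ d′ → (n′ ⊖ d′) ⊗ d ⊖ (n ⊖ d) ⊗ d′ ⊜ n′ ⊗ d ⊖ n ⊗ d′) ≋-refl N D (deriv N) (deriv D) ⟩
    W
      ∎
    where open ≋-Reasoning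

  W≋U^ₚ-*ₚ : ∀ s → s ≤ 2 * k → W ≋ U ^ₚ s *ₚ (constₚ cW *ₚ X ^ₚ a *ₚ U ^ₚ (2 * k ∸ s))
  W≋U^ₚ-*ₚ s s≤2k = begin
    W
      ≈⟨ W≋cW·T ⟩
    cW ·ₚ (X ^ₚ a *ₚ U ^ₚ (2 * k))
      ≈⟨ ·ₚ≋constₚ-*ₚ cW T ⟩
    constₚ cW *ₚ (X ^ₚ a *ₚ U ^ₚ (2 * k))
      ≡⟨ cong (λ e → constₚ cW *ₚ (X ^ₚ a *ₚ U ^ₚ e)) (ℕP.m+[n∸m]≡n s≤2k) ⟨
    constₚ cW *ₚ (X ^ₚ a *ₚ U ^ₚ (s + (2 * k ∸ s)))
      ≈⟨ *ₚ-congˡ (constₚ cW) (*ₚ-congˡ (X ^ₚ a) (^ₚ-+ U s (2 * k ∸ s))) ⟩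
    constₚ cW *ₚ (X ^ₚ a *ₚ (U ^ₚ s *ₚ U ^ₚ (2 * k ∸ s)))
      ≈⟨ psolve 4 (λ c x u v → c ⊗ (x ⊗ (u ⊗ v)) ⊜ u ⊗ (c ⊗ x ⊗ v)) ≋-refl (constₚ cW) (X ^ₚ a) (U ^ₚ s) (U ^ₚ (2 * k ∸ s)) ⟩
    U ^ₚ s *ₚ (constₚ cW *ₚ X ^ₚ a *ₚ U ^ₚ (2 * k ∸ s))
      ∎
    where open ≋-Reasoning

  E-cofactor-at-1 : ∀ s → s ≤ 2 * k → ∀ G → E ≋ U ^ₚ suc s *ₚ G →
                  ℕ→ℚ (suc s) ℚ.* eval G 1ℚ ℚ.* eval D 1ℚ ≡ cW ℚ.* eval (U ^ₚ (2 * k ∸ s)) 1ℚ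
  E-cofactor-at-1 s s≤2k G E≋ = begin
    ℕ→ℚ (suc s) ℚ.* eval G 1ℚ ℚ.* eval D 1ℚ
      ≡⟨ eval-W-cofactor {U} {1ℚ} eval-U-1 (suc s) G D W[ G , D ] ⟨
    eval (natₚ (suc s) *ₚ G *ₚ D +ₚ U *ₚ W[ G , D ]) 1ℚ
      ≡⟨ eval-cong 1ℚ cofactors≋ ⟩
    eval (constₚ cW *ₚ X ^ₚ a *ₚ U ^ₚ (2 * k ∸ s)) 1ℚ
      ≡⟨ eval-* (constₚ cW *ₚ X ^ₚ a) (U ^ₚ (2 * k ∸ s)) 1ℚ ⟩
    eval (constₚ cW *ₚ X ^ₚ a) 1ℚ ℚ.* eval (U ^ₚ (2 * k ∸ s)) 1ℚ
      ≡⟨ cong (ℚ._* eval (U ^ₚ (2 * k ∸ s)) 1ℚ) (trans (eval-* (constₚ cW) (X ^ₚ a) 1ℚ)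
           (trans (cong₂ ℚ._*_ (eval-constₚ cW 1ℚ) (eval-^ₚ-1 {X} {1ℚ} (eval-X 1ℚ) a)) (ℚP.*-identityʳ cW))) ⟩
    cW ℚ.* eval (U ^ₚ (2 * k ∸ s)) 1ℚ
      ∎
    where
    open ≡-Reasoning
    cofactors≋ : natₚ (suc s) *ₚ G *ₚ D +ₚ U *ₚ W[ G , D ] ≋ constₚ cW *ₚ X ^ₚ a *ₚ U ^ₚ (2 * k ∸ s)
    cofactors≋ = U^ₚ-*ₚ-cancelˡ s (≋-trans (≋-sym (W-^ₚ-suc deriv-U s G D))
                                  (≋-trans (≋-sym (W-cong E≋ ≋-refl)) (≋-trans W[E,D]≋W (W≋U^ₚ-*ₚ s s≤2k))))

  E-factor : Σ Poly λ M → (E ≋ U ^ₚ (2 * k + 1) *ₚ M) × (eval M 1ℚ ≢ 0ℚ)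
  E-factor = M , E≋ , M[1]≢0
    where
    root : ∀ s G → s < 2 * k → E ≋ U ^ₚ suc s *ₚ G → eval G 1ℚ ≡ 0ℚ
    root s G s<2k E≋ = x*y≡0⇒y≡0 {ℕ→ℚ (suc s)} (ℕ→ℚ-≢0 {suc s} λ ()) (x*y≡0⇒y≡0 {eval D 1ℚ} D[1]≢0 (begin
      eval D 1ℚ ℚ.* (ℕ→ℚ (suc s) ℚ.* eval G 1ℚ)                 ≡⟨ ℚP.*-comm (eval D 1ℚ) _ ⟩
      ℕ→ℚ (suc s) ℚ.* eval G 1ℚ ℚ.* eval D 1ℚ                   ≡⟨ E-cofactor-at-1 s (ℕP.<⇒≤ s<2k) G E≋ ⟩
      cW ℚ.* eval (U ^ₚ (2 * k ∸ s)) 1ℚ                          ≡⟨ cong (λ e → cW ℚ.* eval (U ^ₚ e) 1ℚ) (ℕP.+-∸-assoc 1 s<2k) ⟩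
      cW ℚ.* eval (U *ₚ U ^ₚ (2 * k ∸ suc s)) 1ℚ                  ≡⟨ cong (cW ℚ.*_) (eval-*ₚ-root {U} {1ℚ} eval-U-1 (U ^ₚ (2 * k ∸ suc s))) ⟩
      cW ℚ.* 0ℚ                                                 ≡⟨ ℚP.*-zeroʳ cW ⟩
      0ℚ                                                        ∎))
      where open ≡-Reasoning
    factor : Σ Poly λ M → E ≋ U ^ₚ suc (2 * k) *ₚ M
    factor = divisible-by-U^ E (2 * k) E[1]≡0 root
    M : Poly
    M = proj₁ factor
    E≋ : E ≋ U ^ₚ (2 * k + 1) *ₚ M
    E≋ = subst (λ e → E ≋ U ^ₚ e *ₚ M) (ℕP.+-comm 1 (2 * k)) (proj₂ factor)
    M[1]≢0 : eval M 1ℚ ≢ 0ℚ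
    M[1]≢0 M[1]≡0 = cW≢0 (begin
      cW                                                ≡⟨ ℚP.*-identityʳ cW ⟨
      cW ℚ.* 1ℚ                                         ≡⟨ cong (λ e → cW ℚ.* eval (U ^ₚ e) 1ℚ) (ℕP.n∸n≡0 (2 * k)) ⟨
      cW ℚ.* eval (U ^ₚ (2 * k ∸ 2 * k)) 1ℚ              ≡⟨ E-cofactor-at-1 (2 * k) ℕP.≤-refl M (proj₂ factor) ⟨
      ℕ→ℚ (suc (2 * k)) ℚ.* eval M 1ℚ ℚ.* eval D 1ℚ      ≡⟨ cong (λ z → ℕ→ℚ (suc (2 * k)) ℚ.* z ℚ.* eval D 1ℚ) M[1]≡0 ⟩
      ℕ→ℚ (suc (2 * k)) ℚ.* 0ℚ ℚ.* eval D 1ℚ             ≡⟨ cong (ℚ._* eval D 1ℚ) (ℚP.*-zeroʳ (ℕ→ℚ (suc (2 * k)))) ⟩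
      0ℚ ℚ.* eval D 1ℚ                                  ≡⟨ ℚP.*-zeroˡ (eval D 1ℚ) ⟩
      0ℚ                                                ∎)
      where open ≡-Reasoning

  Bezout-N-D : Bezout N D
  Bezout-N-D = Bezout-Wronskian cW cW≢0 W≋cW·T (Bezout-*ʳ (Bezout-^ʳ Bezout-D-X a) (Bezout-^ʳ Bezout-D-U (2 * k)))
    where
    Bezout-D-X : Bezout D X
    Bezout-D-X = Bezout-remainder (drop 1 D) (coeff D 0) D[0]≢0 (p≋X*drop1+p₀ D)
    Bezout-D-U : Bezout D U
    Bezout-D-U = Bezout-remainder (quotientU D) (eval D 1ℚ) D[1]≢0 (divisionU D)

proposition3p4 : (d k : ℕ) → 1 ≤ k → 2 * k + 1 ≤ d →
    IsNormalizedBelyi d (d ∸ k) (2 * k + 1) (d ∸ k) (belyiNum d k) (belyiDen d k)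
    × ((i : ℕ) → i ≤ k → coefA d k i ≡ (k !) * (d C i) * ((d ∸ k ∸ i ∸ 1) C (k ∸ i)))
proposition3p4 d k _ 2k+1≤d = isNormalizedBelyi , coefA-closed-form d k
  where
  open BelyiMap d k 2k+1≤d
  isNormalizedBelyi : IsNormalizedBelyi d (d ∸ k) (2 * k + 1) (d ∸ k) N D
  isNormalizedBelyi = record
    { coprime    = let (A , B′ , AN+B′D≋1) = Bezout-N-D in A , B′ , get AN+B′D≋1
    ; degN       = N-degree
    ; degD       = subst (DegreeIs D) (sym d∸[d∸k]≡k) D-degree
    ; at0        = P , (λ _ → refl) , P[0]≢0
    ; at1        = let (M , E≋ , M[1]≢0) = E-factor in M , get E≋ , M[1]≢0
    ; unramified = cW , cW≢0 , get (subst (λ e → W ≋ cW ·ₚ (X ^ₚ a *ₚ U ^ₚ e)) (sym (ℕP.m+n∸n≡m (2 * k) 1)) W≋cW·T)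
    }
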